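{- Let $n\ge1$ and let $\Delta^+$ be the set of positive roots of the root system of type $A_n$, with the root order, and let $\mathfrak X:\mathrm{AN}(\Delta^+)\to\mathrm{AN}(\Delta^+)$ be its reverse operator. Then the OY-number $\mathcal Y$ is $\mathfrak X$-invariant: $\mathcal Y(\Gamma)=\mathcal Y(\mathfrak X(\Gamma))$ for every antichain $\Gamma\in\mathrm{AN}(\Delta^+)$.
   Context: Write $\Delta^+=\{\varepsilon_i-\varepsilon_{j+1}\mid 1\le i\le j\le n\}$ with simple roots $\alpha_i=\varepsilon_i-\varepsilon_{i+1}$; the root order is $x\preccurlyeq y$ iff $y-x$ is a non-negative integral combination of simple roots. An antichain is a set of mutually incomparable roots (including $\varnothing$); $\mathrm{AN}(\Delta^+)$ is the set of antichains. For $\Gamma$ an antichain, $\mathcal I(\Gamma)=\{x\in\Delta^+\mid\exists\gamma\in\Gamma,\ \gamma\preccurlyeq x\}$; for a subset $S$, $S_{min},S_{max}$ are its minimal/maximal elements. The reverse operator is $\mathfrak X(\Gamma)=(\Delta^+\setminus\mathcal I(\Gamma))_{max}$. OY-number: for a non-empty antichain $\Gamma=\{\gamma_1,\dots,\gamma_k\}$ with $\mathcal I=\mathcal I(\Gamma)$, set $r_\Gamma(\gamma_s)=\#(\mathcal I\setminus\{\gamma_s\})_{min}-\#\mathcal I_{min}+1$ and $\mathcal Y(\Gamma)=\sum_{s=1}^k r_\Gamma(\gamma_s)$; set $\mathcal Y(\varnothing)=0$. -}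

module Defs where

open import Data.Nat using (ℕ; zero; suc; _≤ᵇ_)
open import Data.Integer using (ℤ; +_; _+_; _-_)
open import Data.Bool using (Bool; true; false; _∧_; _∨_; not; if_then_else_; T)
open import Data.Fin using (Fin; toℕ)
open import Data.Fin.Properties using () renaming (_≟_ to _≟F_)
open import Data.Product using (_×_; _,_; proj₁; proj₂)
open import Data.List using (List; []; _∷_; filter; length; allFin; concatMap; map; foldr)
open import Data.Bool.ListAction using (all; any)
open import Relation.Nullary.Decidable using (⌊_⌋)
open import Relation.Binary.PropositionalEquality using (_≡_)

-- Indexing convention (0-based): a pair (i , j) : Fin n × Fin n with i ≤ j
-- stands for the positive root ε_{i+1} - ε_{j+2} = α_{i+1} + ... + α_{j+1}
-- of type A_n.  Pairs with i > j are not roots and are ignored everywhere.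
Pair : ℕ → Set
Pair n = Fin n × Fin n

roots : (n : ℕ) → List (Pair n)
roots n = filter (λ p → toℕ (proj₁ p) Data.Nat.≤? toℕ (proj₂ p))
                 (concatMap (λ i → map (λ j → (i , j)) (allFin n)) (allFin n))

coeff : {n : ℕ} → Pair n → Fin n → ℕ
coeff (i , j) k = if (toℕ i ≤ᵇ toℕ k) ∧ (toℕ k ≤ᵇ toℕ j) then 1 else 0

-- root order: x ≼ y iff y - x is a non-negative integral combination of
-- simple roots, i.e. every simple-root coefficient of y - x is ≥ 0.
_≼ᵇ_ : {n : ℕ} → Pair n → Pair n → Bool
_≼ᵇ_ {n} x y = all (λ k → coeff x k ≤ᵇ coeff y k) (allFin n)

_==_ : {n : ℕ} → Pair n → Pair n → Bool
(i , j) == (i' , j') = ⌊ i ≟F i' ⌋ ∧ ⌊ j ≟F j' ⌋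

-- subsets of Δ⁺ as boolean characteristic functions (only values on roots matter)
Subset : ℕ → Set
Subset n = Pair n → Bool

IsAntichain : {n : ℕ} → Subset n → Set
IsAntichain {n} Γ = T (all (λ x → all (λ y →
   not (Γ x ∧ Γ y ∧ not (x == y) ∧ (x ≼ᵇ y))) (roots n)) (roots n))

card : {n : ℕ} → Subset n → ℕ
card {n} S = length (filter (λ x → T? (S x)) (roots n))
  where
  open import Data.Bool.Properties using () renaming (T? to T?)

upper : {n : ℕ} → Subset n → Subset n
upper {n} Γ x = any (λ γ → Γ γ ∧ (γ ≼ᵇ x)) (roots n)

minOf : {n : ℕ} → Subset n → Subset n
minOf {n} S x = S x ∧ all (λ y → not (S y ∧ (y ≼ᵇ x) ∧ not (y == x))) (roots n)

maxOf : {n : ℕ} → Subset n → Subset n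
maxOf {n} S x = S x ∧ all (λ y → not (S y ∧ (x ≼ᵇ y) ∧ not (y == x))) (roots n)

compl : {n : ℕ} → Subset n → Subset n
compl S x = not (S x)

remove : {n : ℕ} → Subset n → Pair n → Subset n
remove S γ x = S x ∧ not (x == γ)

𝔛 : {n : ℕ} → Subset n → Subset n
𝔛 Γ = maxOf (compl (upper Γ))

rΓ : {n : ℕ} → Subset n → Pair n → ℤ
rΓ Γ γ = ((+ card (minOf (remove (upper Γ) γ))) - (+ card (minOf (upper Γ)))) + (+ 1)

𝒴 : {n : ℕ} → Subset n → ℤ
𝒴 {n} Γ = foldr _+_ (+ 0) (map (rΓ Γ) (filter (λ x → T? (Γ x)) (roots n)))
  where
  open import Data.Bool.Properties using () renaming (T? to T?)

-- A positive root ε_{i+1} − ε_{j+2} is the interval [i, j]; the root order is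
-- containment, so in an antichain Γ distinct elements have distinct left ends
-- and distinct right ends.  Removing γ = [i, j] from 𝓘(Γ) can only create the
-- new minimal elements [i − 1, j] and [i, j + 1], and it does so exactly when no
-- element of Γ starts at i − 1, resp. ends at j + 1.  Hence 𝒴(Γ) is the number
-- of ascents of the word recording the left ends of Γ plus the number of
-- descents of the word recording its right ends.  A maximal element of
-- Δ⁺ ∖ 𝓘(Γ) starting at c exists iff c − 1 is a left end of Γ (or c = 0) and
-- [c, c] ∉ Γ, and symmetrically for right ends; so the words of 𝔛(Γ) are those
-- of Γ shifted by one place and masked by the diagonal of Γ, and a telescoping
-- argument shows that this leaves ascents plus descents unchanged.

module Submission where

open import Defs
open import Data.Nat using (ℕ; _≥_)
open import Relation.Binary.PropositionalEquality using (_≡_)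

open import Data.Nat using (zero; suc; _+_; _*_; _∸_; _≤_; _<_; _≤ᵇ_; _≡ᵇ_; z≤n; s≤s; s≤s⁻¹; _≤?_; _<?_)
open import Data.Nat.Properties
open import Algebra.Properties.CommutativeSemigroup +-commutativeSemigroup using (interchange; xy∙z≈xz∙y)
open import Data.Nat.Tactic.RingSolver using (solve-∀)
open import Data.Integer as ℤ using (ℤ; +_; _⊖_)
open import Data.Integer.Properties using ([+m]-[+n]≡m⊖n; distribˡ-⊖-+-pos; ⊖-≥; pos-+)
open import Data.Bool using (Bool; true; false; _∧_; _∨_; not; T)
open import Data.Bool.Properties using (T-∧; T-∨; T-≡; T-not-≡; T?; ∨-zeroʳ; ∧-zeroʳ)
open import Data.Unit using (tt)
open import Data.Empty using (⊥-elim)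
open import Data.Fin using (Fin; toℕ; fromℕ<)
open import Data.Fin.Properties using (toℕ-injective; toℕ<n; toℕ-fromℕ<) renaming (_≟_ to _≟F_)
open import Data.Product using (_×_; _,_; proj₁; proj₂; ∃-syntax)
open import Data.Product.Properties using (≡-dec)
open import Data.Sum using (_⊎_; inj₁; inj₂)
open import Data.List using (List; []; _∷_; filter; length; foldr; allFin; concatMap; map; cartesianProduct; _++_)
open import Data.Bool.ListAction using (all; any)
open import Data.List.Membership.Propositional using (_∈_; find; lose)
open import Data.List.Membership.Propositional.Properties using (∈-filter⁺; ∈-filter⁻; ∈-cartesianProduct⁺; ∈-allFin)
open import Data.List.Relation.Unary.Any using (Any; here; there)
import Data.List.Relation.Unary.Any as Any
import Data.List.Relation.Unary.All as All
open import Data.List.Relation.Unary.All.Properties using (all⁺; all⁻)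
open import Data.List.Relation.Unary.Any.Properties using (any⁺; any⁻)
open import Data.List.Relation.Unary.Unique.Propositional using (Unique)
open import Data.List.Relation.Unary.AllPairs using (_∷_)
import Data.List.Relation.Unary.Unique.Propositional.Properties as Unique
open import Relation.Nullary using (¬_; Dec; yes; no)
open import Relation.Unary using (Decidable)
import Relation.Nullary.Decidable as Dec
open import Relation.Nullary.Decidable using (⌊_⌋; toWitness; fromWitness; _×-dec_; ¬?)
open import Relation.Binary.PropositionalEquality using (refl; sym; trans; cong; cong₂; subst; subst₂; _≢_; module ≡-Reasoning)
open import Function using (_∘_; flip; case_of_; _⇔_; mk⇔)
open import Function.Bundles using (Equivalence)
open Equivalence using (to; from)

T∧⁻ : ∀ {a b} → T (a ∧ b) → T a × T b
T∧⁻ = to T-∧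

T∧⁺ : ∀ {a b} → T a → T b → T (a ∧ b)
T∧⁺ p q = from T-∧ (p , q)

T-not⁺ : ∀ {a} → ¬ T a → T (not a)
T-not⁺ {true} ¬a = ¬a tt
T-not⁺ {false} _ = tt

T-not⁻ : ∀ {a} → T (not a) → ¬ T a
T-not⁻ {true} ()

T-ext : ∀ {a b} → (T a → T b) → (T b → T a) → a ≡ b
T-ext {true} {true} _ _ = refl
T-ext {true} {false} f _ = ⊥-elim (f tt)
T-ext {false} {true} _ g = ⊥-elim (g tt)
T-ext {false} {false} _ _ = refl

any⇔ : ∀ {A : Set} (p : A → Bool) (xs : List A) → T (any p xs) ⇔ (∃[ x ] (x ∈ xs × T (p x)))
any⇔ p xs = mk⇔ (find ∘ any⁻ p xs) (λ (x , x∈ , px) → any⁺ p (lose x∈ px))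

≡ᵇ⇔≡ : ∀ {a b} → T (a ≡ᵇ b) ⇔ a ≡ b
≡ᵇ⇔≡ {a} {b} = mk⇔ (≡ᵇ⇒≡ a b) (≡⇒≡ᵇ a b)

<-predecessor : ∀ {a b} → a < b → ∃[ i ] (suc i ≡ b × a ≤ i)
<-predecessor {b = suc i} (s≤s a≤i) = i , refl , a≤i

≡ᵇ-refl : ∀ a → (a ≡ᵇ a) ≡ true
≡ᵇ-refl a = to T-≡ (≡⇒≡ᵇ a a refl)

<⇒≡ᵇ≡false : ∀ {a b} → a < b → (a ≡ᵇ b) ≡ false
<⇒≡ᵇ≡false {a} {b} a<b = to T-not-≡ (T-not⁺ (<⇒≢ a<b ∘ ≡ᵇ⇒≡ a b))

-- Roots as intervals

module _ {n : ℕ} where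

  lo hi : Pair n → ℕ
  lo = toℕ ∘ proj₁
  hi = toℕ ∘ proj₂

  Root : Pair n → Set
  Root x = x ∈ roots n

  roots-as-product : roots n ≡ filter (λ x → lo x ≤? hi x) (cartesianProduct (allFin n) (allFin n))
  roots-as-product = cong (filter (λ x → lo x ≤? hi x)) (concatMap≡cartesianProduct (allFin n))
    where
    concatMap≡cartesianProduct : (is : List (Fin n)) →
      concatMap (λ i → map (i ,_) (allFin n)) is ≡ cartesianProduct is (allFin n)
    concatMap≡cartesianProduct [] = refl
    concatMap≡cartesianProduct (i ∷ is) = cong (map (i ,_) (allFin n) ++_) (concatMap≡cartesianProduct is)

  roots-unique : Unique (roots n)
  roots-unique = subst Unique (sym roots-as-product) (Unique.filter⁺ (λ x → lo x ≤? hi x)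
    (Unique.cartesianProduct⁺ (Unique.allFin⁺ n) (Unique.allFin⁺ n)))

  Root⇔ : ∀ {x} → Root x ⇔ lo x ≤ hi x
  Root⇔ {x} = mk⇔
    (λ x∈ → proj₂ (∈-filter⁻ (λ x → lo x ≤? hi x) {xs = cartesianProduct (allFin n) (allFin n)}
                              (subst (x ∈_) roots-as-product x∈)))
    (λ le → subst (x ∈_) (sym roots-as-product)
      (∈-filter⁺ (λ x → lo x ≤? hi x) (∈-cartesianProduct⁺ (∈-allFin _) (∈-allFin _)) le))

  lo≤hi : ∀ {x} → Root x → lo x ≤ hi x
  lo≤hi = to Root⇔

  hi<n : (x : Pair n) → hi x < n
  hi<n x = toℕ<n (proj₂ x)

  ≡-byCoords : ∀ {x y} → lo x ≡ lo y → hi x ≡ hi y → x ≡ y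
  ≡-byCoords {i , j} {i' , j'} p q with toℕ-injective p | toℕ-injective q
  ... | refl | refl = refl

  rootAt : ∀ {a b} → a ≤ b → b < n → ∃[ x ] (Root x × lo x ≡ a × hi x ≡ b)
  rootAt {a} {b} a≤b b<n = x , from Root⇔ (subst₂ _≤_ (sym lo≡) (sym hi≡) a≤b) , lo≡ , hi≡
    where
    x : Pair n
    x = fromℕ< (≤-<-trans a≤b b<n) , fromℕ< b<n
    lo≡ : lo x ≡ a
    lo≡ = toℕ-fromℕ< (≤-<-trans a≤b b<n)
    hi≡ : hi x ≡ b
    hi≡ = toℕ-fromℕ< b<n

  infix 4 _⊑_

  _⊑_ : Pair n → Pair n → Set
  x ⊑ y = lo y ≤ lo x × hi x ≤ hi y

  ⊑-refl : ∀ {x} → x ⊑ x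
  ⊑-refl = ≤-refl , ≤-refl

  ⊑-trans : ∀ {x y z} → x ⊑ y → y ⊑ z → x ⊑ z
  ⊑-trans (p , q) (p' , q') = ≤-trans p' p , ≤-trans q q'

  ⊑-antisym : ∀ {x y} → x ⊑ y → y ⊑ x → x ≡ y
  ⊑-antisym (p , q) (p' , q') = ≡-byCoords (≤-antisym p' p) (≤-antisym q q')

  private
    ≤ᵇ≡true⇔ : ∀ {a b} → (a ≤ᵇ b) ≡ true ⇔ a ≤ b
    ≤ᵇ≡true⇔ {a} {b} = mk⇔ (≤ᵇ⇒≤ a b ∘ from T-≡) (to T-≡ ∘ ≤⇒≤ᵇ)

  coeff≡1 : ∀ {x k} → lo x ≤ toℕ k → toℕ k ≤ hi x → coeff x k ≡ 1
  coeff≡1 {i , j} p q rewrite from ≤ᵇ≡true⇔ p | from ≤ᵇ≡true⇔ q = refl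

  coeff-support : ∀ {x k} → 1 ≤ coeff x k → lo x ≤ toℕ k × toℕ k ≤ hi x
  coeff-support {i , j} {k} pos with toℕ i ≤ᵇ toℕ k in e₁ | toℕ k ≤ᵇ toℕ j in e₂
  ... | true  | true  = to ≤ᵇ≡true⇔ e₁ , to ≤ᵇ≡true⇔ e₂
  ... | true  | false = ⊥-elim (1+n≰n pos)
  ... | false | _     = ⊥-elim (1+n≰n pos)

  coeff-mono : ∀ {x y} → x ⊑ y → ∀ k → coeff x k ≤ coeff y k
  coeff-mono {i , j} {y} (p , q) k with toℕ i ≤ᵇ toℕ k in e₁ | toℕ k ≤ᵇ toℕ j in e₂
  ... | true  | true  = ≤-reflexive (sym (coeff≡1 {y} (≤-trans p (to ≤ᵇ≡true⇔ e₁))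
                                                      (≤-trans (to ≤ᵇ≡true⇔ e₂) q)))
  ... | true  | false = z≤n
  ... | false | _     = z≤n

  ≼ᵇ⇔⊑ : ∀ {x y} → Root x → T (x ≼ᵇ y) ⇔ x ⊑ y
  ≼ᵇ⇔⊑ {x} {y} x∈ = mk⇔ sound complete
    where
    at-end : ∀ k → T (x ≼ᵇ y) → coeff x k ≡ 1 → lo y ≤ toℕ k × toℕ k ≤ hi y
    at-end k h e = coeff-support (subst (_≤ coeff y k) e
      (≤ᵇ⇒≤ _ _ (All.lookup (all⁺ _ (allFin n) h) (∈-allFin k))))
    sound : T (x ≼ᵇ y) → x ⊑ y
    sound h = proj₁ (at-end (proj₁ x) h (coeff≡1 ≤-refl (lo≤hi x∈))) ,
              proj₂ (at-end (proj₂ x) h (coeff≡1 (lo≤hi x∈) ≤-refl))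
    complete : x ⊑ y → T (x ≼ᵇ y)
    complete x⊑y = all⁻ (λ k → coeff x k ≤ᵇ coeff y k) {xs = allFin n}
      (All.tabulate λ {k} _ → ≤⇒≤ᵇ (coeff-mono x⊑y k))

T-not-strict⇔ : ∀ {a b c} → T (not (a ∧ b ∧ not c)) ⇔ (T a → T b → T c)
T-not-strict⇔ {true} {true} {true} = mk⇔ (λ _ _ _ → tt) (λ _ → tt)
T-not-strict⇔ {true} {true} {false} = mk⇔ (λ ()) (λ f → f tt tt)
T-not-strict⇔ {true} {false} = mk⇔ (λ _ _ ()) (λ _ → tt)
T-not-strict⇔ {false} = mk⇔ (λ _ ()) (λ _ → tt)

module _ {n : ℕ} where

  ==⇔≡ : {x y : Pair n} → T (x == y) ⇔ x ≡ y
  ==⇔≡ {i , j} {i' , j'} = mk⇔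
    (λ h → let (p , q) = T∧⁻ {⌊ i ≟F i' ⌋} h in cong₂ _,_ (toWitness p) (toWitness q))
    (λ { refl → T∧⁺ {⌊ i ≟F i ⌋} (fromWitness refl) (fromWitness refl) })

  infix 4 _∈ₛ_

  _∈ₛ_ : Pair n → Subset n → Set
  x ∈ₛ S = Root x × T (S x)

  Antichain : Subset n → Set
  Antichain Γ = ∀ {x y} → x ∈ₛ Γ → y ∈ₛ Γ → x ⊑ y → x ≡ y

  IsAntichain⇒Antichain : (Γ : Subset n) → IsAntichain Γ → Antichain Γ
  IsAntichain⇒Antichain Γ h {x} {y} (x∈ , Γx) (y∈ , Γy) x⊑y with x == y in e
  ... | true  = to ==⇔≡ (subst T (sym e) tt)
  ... | false = ⊥-elim (T-not⁻ incomparable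
                  (T∧⁺ Γx (T∧⁺ Γy (T∧⁺ (subst (T ∘ not) (sym e) tt) (from (≼ᵇ⇔⊑ x∈) x⊑y)))))
    where
    incomparable : T (not (Γ x ∧ Γ y ∧ not (x == y) ∧ (x ≼ᵇ y)))
    incomparable = All.lookup (all⁺ _ (roots n) (All.lookup (all⁺ _ (roots n) h) x∈)) y∈

  Within : Subset n → ℕ → ℕ → Set
  Within Γ c d = ∃[ g ] (g ∈ₛ Γ × c ≤ lo g × hi g ≤ d)

  upper⇔ : ∀ {Γ x} → T (upper Γ x) ⇔ Within Γ (lo x) (hi x)
  upper⇔ {Γ = Γ} {x} = mk⇔
    (λ h → let (g , g∈ , p) = to (any⇔ _ (roots n)) h
               (Γg , g≼x) = T∧⁻ p
           in g , (g∈ , Γg) , to (≼ᵇ⇔⊑ g∈) g≼x)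
    (λ (g , (g∈ , Γg) , g⊑x) → from (any⇔ _ (roots n))
           (g , g∈ , T∧⁺ Γg (from (≼ᵇ⇔⊑ g∈) g⊑x)))

  IsMin IsMax : Subset n → Pair n → Set
  IsMin S x = x ∈ₛ S × (∀ {y} → y ∈ₛ S → y ⊑ x → y ≡ x)
  IsMax S x = x ∈ₛ S × (∀ {y} → y ∈ₛ S → x ⊑ y → y ≡ x)

  private
    all-roots⇔ : ∀ {p : Pair n → Bool} → T (all p (roots n)) ⇔ (∀ {y} → Root y → T (p y))
    all-roots⇔ {p} = mk⇔ (λ h {y} → All.lookup (all⁺ p (roots n) h)) complete
      where
      complete : (∀ {y} → Root y → T (p y)) → T (all p (roots n))
      complete f = all⁻ p (All.tabulate f)

    no-strict⇔ : ∀ {S : Subset n} {x} {r : Pair n → Bool} {R : Pair n → Set} →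
      (∀ {y} → Root y → T (r y) ⇔ R y) →
      T (all (λ y → not (S y ∧ r y ∧ not (y == x))) (roots n)) ⇔ (∀ {y} → y ∈ₛ S → R y → y ≡ x)
    no-strict⇔ r⇔R = mk⇔
      (λ h {y} (y∈ , Sy) ry → to ==⇔≡
        (to T-not-strict⇔ (to all-roots⇔ h y∈) Sy (from (r⇔R y∈) ry)))
      (λ f → from all-roots⇔ λ {y} y∈ → from T-not-strict⇔ λ Sy ry →
        from ==⇔≡ (f (y∈ , Sy) (to (r⇔R y∈) ry)))

  minOf⇔ : ∀ {S x} → Root x → T (minOf S x) ⇔ IsMin S x
  minOf⇔ {S} {x} x∈ = mk⇔ forth back
    where
    no-smaller⇔ : T (all (λ y → not (S y ∧ (y ≼ᵇ x) ∧ not (y == x))) (roots n)) ⇔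
                  (∀ {y} → y ∈ₛ S → y ⊑ x → y ≡ x)
    no-smaller⇔ = no-strict⇔ ≼ᵇ⇔⊑
    forth : T (minOf S x) → IsMin S x
    forth h = let (Sx , rest) = T∧⁻ h in (x∈ , Sx) , to no-smaller⇔ rest
    back : IsMin S x → T (minOf S x)
    back ((_ , Sx) , f) = T∧⁺ Sx (from no-smaller⇔ f)

  maxOf⇔ : ∀ {S x} → Root x → T (maxOf S x) ⇔ IsMax S x
  maxOf⇔ {S} {x} x∈ = mk⇔ forth back
    where
    no-larger⇔ : T (all (λ y → not (S y ∧ (x ≼ᵇ y) ∧ not (y == x))) (roots n)) ⇔
                 (∀ {y} → y ∈ₛ S → x ⊑ y → y ≡ x)
    no-larger⇔ = no-strict⇔ (λ _ → ≼ᵇ⇔⊑ x∈)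
    forth : T (maxOf S x) → IsMax S x
    forth h = let (Sx , rest) = T∧⁻ h in (x∈ , Sx) , to no-larger⇔ rest
    back : IsMax S x → T (maxOf S x)
    back ((_ , Sx) , f) = T∧⁺ Sx (from no-larger⇔ f)

⟦_⟧ : Bool → ℕ
⟦ true ⟧ = 1
⟦ false ⟧ = 0

⟦∧⟧ : ∀ a b → ⟦ a ∧ b ⟧ ≡ ⟦ a ⟧ * ⟦ b ⟧
⟦∧⟧ true b = sym (*-identityˡ ⟦ b ⟧)
⟦∧⟧ false b = refl

⟦⟧≡0 : ∀ {a} → ¬ T a → ⟦ a ⟧ ≡ 0
⟦⟧≡0 {true} ¬a = ⊥-elim (¬a tt)
⟦⟧≡0 {false} _ = refl

⟦⟧≡1 : ∀ {a} → T a → ⟦ a ⟧ ≡ 1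
⟦⟧≡1 {true} _ = refl

⟦⟧-split : ∀ {a e} → (T e → T a) → ⟦ a ⟧ ≡ ⟦ a ∧ not e ⟧ + ⟦ e ⟧
⟦⟧-split {true} {true} _ = refl
⟦⟧-split {true} {false} _ = refl
⟦⟧-split {false} {true} e⇒a = ⊥-elim (e⇒a tt)
⟦⟧-split {false} {false} _ = refl

⟦⟧-partition : ∀ {b c₁ c₂ c₃} → (T b ⇔ (T c₁ ⊎ T c₂ ⊎ T c₃)) →
  (T c₁ → ¬ T c₂) → (T c₁ → ¬ T c₃) → (T c₂ → ¬ T c₃) → ⟦ b ⟧ ≡ ⟦ c₁ ⟧ + ⟦ c₂ ⟧ + ⟦ c₃ ⟧
⟦⟧-partition {c₁ = true} {true} _ d₁₂ _ _ = ⊥-elim (d₁₂ tt tt)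
⟦⟧-partition {c₁ = true} {false} {true} _ _ d₁₃ _ = ⊥-elim (d₁₃ tt tt)
⟦⟧-partition {c₁ = true} {false} {false} b⇔ _ _ _ = ⟦⟧≡1 (from b⇔ (inj₁ tt))
⟦⟧-partition {c₁ = false} {true} {true} _ _ _ d₂₃ = ⊥-elim (d₂₃ tt tt)
⟦⟧-partition {c₁ = false} {true} {false} b⇔ _ _ _ = ⟦⟧≡1 (from b⇔ (inj₂ (inj₁ tt)))
⟦⟧-partition {c₁ = false} {false} {true} b⇔ _ _ _ = ⟦⟧≡1 (from b⇔ (inj₂ (inj₂ tt)))
⟦⟧-partition {c₁ = false} {false} {false} b⇔ _ _ _ = ⟦⟧≡0 λ b → case to b⇔ b of λ
  { (inj₁ ()) ; (inj₂ (inj₁ ())) ; (inj₂ (inj₂ ())) }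

∑ : {A : Set} → List A → (A → ℕ) → ℕ
∑ [] f = 0
∑ (x ∷ xs) f = f x + ∑ xs f

syntax ∑ xs (λ x → e) = ∑[ x ∈ xs ] e

∑< : ℕ → (ℕ → ℕ) → ℕ
∑< zero f = 0
∑< (suc m) f = ∑< m f + f m

syntax ∑< m (λ k → e) = ∑[ k < m ] e

module _ {A : Set} where

  ∑-cong : ∀ xs {f g : A → ℕ} → (∀ {x} → x ∈ xs → f x ≡ g x) → ∑ xs f ≡ ∑ xs g
  ∑-cong [] _ = refl
  ∑-cong (x ∷ xs) f≡g = cong₂ _+_ (f≡g (here refl)) (∑-cong xs (f≡g ∘ there))

  ∑-+ : ∀ xs (f g : A → ℕ) → ∑[ x ∈ xs ] (f x + g x) ≡ ∑ xs f + ∑ xs g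
  ∑-+ [] f g = refl
  ∑-+ (x ∷ xs) f g = trans (cong (_+_ (f x + g x)) (∑-+ xs f g)) (interchange (f x) (g x) (∑ xs f) (∑ xs g))

  ∑-*ʳ : ∀ xs (f : A → ℕ) c → ∑[ x ∈ xs ] (f x * c) ≡ ∑ xs f * c
  ∑-*ʳ [] f c = refl
  ∑-*ʳ (x ∷ xs) f c = trans (cong (_+_ (f x * c)) (∑-*ʳ xs f c)) (sym (*-distribʳ-+ c (f x) (∑ xs f)))

  count-none : ∀ xs (p : A → Bool) → (∀ {x} → x ∈ xs → ¬ T (p x)) → ∑[ x ∈ xs ] ⟦ p x ⟧ ≡ 0
  count-none [] p _ = refl
  count-none (x ∷ xs) p none = cong₂ _+_ (⟦⟧≡0 (none (here refl))) (count-none xs p (none ∘ there))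

  count-atMostOne : ∀ {xs} (p : A → Bool) → Unique xs →
    (∀ {x y} → x ∈ xs → y ∈ xs → T (p x) → T (p y) → x ≡ y) → ∑[ x ∈ xs ] ⟦ p x ⟧ ≡ ⟦ any p xs ⟧
  count-atMostOne {[]} p _ _ = refl
  count-atMostOne {x ∷ xs} p (x∉xs ∷ unique) one with p x in e
  ... | true  = cong suc (count-none xs p λ y∈ py →
                  All.lookup x∉xs y∈ (one (here refl) (there y∈) (subst T (sym e) tt) py))
  ... | false = count-atMostOne p unique (λ x∈ y∈ → one (there x∈) (there y∈))

  count-exactlyOne : ∀ {xs} (p : A → Bool) → Unique xs → ∀ {c} → c ∈ xs →
    (∀ {x} → x ∈ xs → T (p x) ⇔ x ≡ c) → ∑[ x ∈ xs ] ⟦ p x ⟧ ≡ 1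
  count-exactlyOne p unique c∈ p⇔ = trans
    (count-atMostOne p unique λ x∈ y∈ px py → trans (to (p⇔ x∈) px) (sym (to (p⇔ y∈) py)))
    (⟦⟧≡1 (from (any⇔ p _) (_ , c∈ , from (p⇔ c∈) refl)))

card≡∑ : ∀ {n} (S : Subset n) → card S ≡ ∑[ x ∈ roots n ] ⟦ S x ⟧
card≡∑ {n} S = go (roots n)
  where
  go : ∀ xs → length (filter (λ x → T? (S x)) xs) ≡ ∑[ x ∈ xs ] ⟦ S x ⟧
  go [] = refl
  go (x ∷ xs) with S x
  ... | true = cong suc (go xs)
  ... | false = go xs

count-at : ∀ {n a b} → a ≤ b → b < n → ∑[ x ∈ roots n ] ⟦ (lo x ≡ᵇ a) ∧ (hi x ≡ᵇ b) ⟧ ≡ 1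
count-at a≤b b<n with rootAt a≤b b<n
... | c , c∈ , lo-c , hi-c = count-exactlyOne _ roots-unique c∈ λ {x} _ → mk⇔
  (λ h → let (lo-x , hi-x) = T∧⁻ h in
         ≡-byCoords (trans (≡ᵇ⇒≡ _ _ lo-x) (sym lo-c)) (trans (≡ᵇ⇒≡ _ _ hi-x) (sym hi-c)))
  (λ { refl → T∧⁺ (≡⇒≡ᵇ _ _ lo-c) (≡⇒≡ᵇ _ _ hi-c) })

∑<-cong : ∀ m {f g : ℕ → ℕ} → (∀ k → k < m → f k ≡ g k) → ∑< m f ≡ ∑< m g
∑<-cong zero _ = refl
∑<-cong (suc m) f≡g = cong₂ _+_ (∑<-cong m λ k k<m → f≡g k (m<n⇒m<1+n k<m)) (f≡g m ≤-refl)

∑<-zero : ∀ m → ∑[ k < m ] 0 ≡ 0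
∑<-zero zero = refl
∑<-zero (suc m) = trans (+-identityʳ _) (∑<-zero m)

∑<-+ : ∀ m (f g : ℕ → ℕ) → ∑[ k < m ] (f k + g k) ≡ ∑< m f + ∑< m g
∑<-+ zero f g = refl
∑<-+ (suc m) f g = trans (cong (_+ (f m + g m)) (∑<-+ m f g)) (interchange (∑< m f) (∑< m g) (f m) (g m))

∑<-indicator : ∀ {m k} (f : ℕ → ℕ) → k < m → ∑[ j < m ] (⟦ k ≡ᵇ j ⟧ * f j) ≡ f k
∑<-indicator {suc m} {k} f k<1+m with k ≟ m
... | yes refl = trans (cong₂ _+_ (vanish m ≤-refl) (cong (_* f k) (⟦⟧≡1 (≡⇒≡ᵇ k k refl))))
                       (*-identityˡ (f k))
  where
  vanish : ∀ j → j ≤ k → ∑[ i < j ] (⟦ k ≡ᵇ i ⟧ * f i) ≡ 0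
  vanish zero _ = refl
  vanish (suc j) j<k = cong₂ _+_ (vanish j (<⇒≤ j<k))
    (cong (_* f j) (⟦⟧≡0 λ k≡j → <-irrefl (sym (≡ᵇ⇒≡ k j k≡j)) j<k))
... | no k≢m = trans (cong₂ _+_ (∑<-indicator f (≤∧≢⇒< (s≤s⁻¹ k<1+m) k≢m))
                                (cong (_* f m) (⟦⟧≡0 (k≢m ∘ ≡ᵇ⇒≡ k m))))
                     (+-identityʳ (f k))

module _ {A : Set} where

  ∑-fibres : ∀ xs (S : A → Bool) (κ : A → ℕ) (f : ℕ → ℕ) {m} → (∀ {x} → x ∈ xs → κ x < m) →
    ∑[ x ∈ xs ] (⟦ S x ⟧ * f (κ x)) ≡ ∑[ k < m ] (∑[ x ∈ xs ] ⟦ S x ∧ (κ x ≡ᵇ k) ⟧ * f k)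
  ∑-fibres [] S κ f {m} _ = sym (∑<-zero m)
  ∑-fibres (x ∷ xs) S κ f {m} κ<m = begin
    ⟦ S x ⟧ * f (κ x) + ∑[ y ∈ xs ] (⟦ S y ⟧ * f (κ y))
      ≡⟨ cong₂ _+_ (sym fibre-of-x) (∑-fibres xs S κ f (κ<m ∘ there)) ⟩
    ∑[ k < m ] (⟦ S x ∧ (κ x ≡ᵇ k) ⟧ * f k) + ∑[ k < m ] (∑[ y ∈ xs ] ⟦ S y ∧ (κ y ≡ᵇ k) ⟧ * f k)
      ≡⟨ sym (∑<-+ m _ _) ⟩
    ∑[ k < m ] (⟦ S x ∧ (κ x ≡ᵇ k) ⟧ * f k + ∑[ y ∈ xs ] ⟦ S y ∧ (κ y ≡ᵇ k) ⟧ * f k)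
      ≡⟨ ∑<-cong m (λ k _ → sym (*-distribʳ-+ (f k) ⟦ S x ∧ (κ x ≡ᵇ k) ⟧ _)) ⟩
    ∑[ k < m ] (∑[ y ∈ x ∷ xs ] ⟦ S y ∧ (κ y ≡ᵇ k) ⟧ * f k) ∎
    where
    open ≡-Reasoning
    fibre-of-x : ∑[ k < m ] (⟦ S x ∧ (κ x ≡ᵇ k) ⟧ * f k) ≡ ⟦ S x ⟧ * f (κ x)
    fibre-of-x with S x
    ... | true  = trans (∑<-indicator f (κ<m (here refl))) (sym (+-identityʳ (f (κ x))))
    ... | false = ∑<-zero m

telescope : ∀ m (s t g : ℕ → ℕ) → (∀ k → k < m → s k + g k ≡ t k + g (suc k)) →
  ∑< m s + g 0 ≡ ∑< m t + g m
telescope zero s t g _ = refl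
telescope (suc m) s t g step = begin
  ∑< m s + s m + g 0         ≡⟨ xy∙z≈xz∙y (∑< m s) (s m) (g 0) ⟩
  ∑< m s + g 0 + s m         ≡⟨ cong (_+ s m) (telescope m s t g λ k k<m → step k (m<n⇒m<1+n k<m)) ⟩
  ∑< m t + g m + s m         ≡⟨ +-assoc (∑< m t) (g m) (s m) ⟩
  ∑< m t + (g m + s m)       ≡⟨ cong (_+_ (∑< m t)) (trans (+-comm (g m) (s m)) (step m ≤-refl)) ⟩
  ∑< m t + (t m + g (suc m)) ≡⟨ sym (+-assoc (∑< m t) (t m) (g (suc m))) ⟩
  ∑< m t + t m + g (suc m)   ∎
  where open ≡-Reasoning

-- Ascents and descents of boolean words

ascents descents : ℕ → (ℕ → Bool) → ℕ
ascents m a = ∑[ k < m ] ⟦ a (suc k) ∧ not (a k) ⟧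
descents m b = ∑[ k < m ] ⟦ b k ∧ not (b (suc k)) ⟧

⟦∧⟧-implied : ∀ {a d} → (T d → T a) → ⟦ a ∧ d ⟧ ≡ ⟦ d ⟧
⟦∧⟧-implied {true} _ = refl
⟦∧⟧-implied {false} {true} d⇒a = ⊥-elim (d⇒a tt)
⟦∧⟧-implied {false} {false} _ = refl

⟦∧∨⟧-equivalent : ∀ {a d} x → (T a → T d) → (T d → T a) → ⟦ a ∧ (x ∨ d) ⟧ ≡ ⟦ d ⟧
⟦∧∨⟧-equivalent {true} {true} x _ _ = cong ⟦_⟧ (∨-zeroʳ x)
⟦∧∨⟧-equivalent {true} {false} _ a⇒d _ = ⊥-elim (a⇒d tt)
⟦∧∨⟧-equivalent {false} {true} _ _ d⇒a = ⊥-elim (d⇒a tt)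
⟦∧∨⟧-equivalent {false} {false} _ _ _ = refl

ascent-step : ∀ a₀ a₁ a₂ d₀ d₁ → (T d₀ → T a₁) → (T d₁ → T a₂) → (T d₁ → T a₁ → T d₀) →
  ⟦ a₂ ∧ not a₁ ⟧ + ⟦ a₁ ∧ (not a₀ ∨ d₀) ⟧ ≡
  ⟦ (a₁ ∧ not d₁) ∧ not (a₀ ∧ not d₀) ⟧ + ⟦ a₂ ∧ (not a₁ ∨ d₁) ⟧
ascent-step true  true  true  true  true  _ _ _ = refl
ascent-step true  true  true  true  false _ _ _ = refl
ascent-step true  true  true  false true  _ _ r = ⊥-elim (r tt tt)
ascent-step true  true  true  false false _ _ _ = refl
ascent-step false true  true  d₀    true  _ _ _ = refl
ascent-step false true  true  d₀    false _ _ _ = refl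
ascent-step a₀    true  false d₀    true  _ q _ = ⊥-elim (q tt)
ascent-step true  true  false true  false _ _ _ = refl
ascent-step true  true  false false false _ _ _ = refl
ascent-step false true  false d₀    false _ _ _ = refl
ascent-step a₀    false true  d₀    d₁    _ _ _ = refl
ascent-step a₀    false false d₀    d₁    _ _ _ = refl

descent-step : ∀ b₀ b₁ b₂ d₀ d₁ → (T d₀ → T b₀) → (T d₁ → T b₁) → (T d₀ → T b₁ → T d₁) →
  ⟦ b₀ ∧ not b₁ ⟧ + ⟦ b₁ ∧ (not b₂ ∨ d₁) ⟧ ≡
  ⟦ (b₁ ∧ not d₀) ∧ not (b₂ ∧ not d₁) ⟧ + ⟦ b₀ ∧ (not b₁ ∨ d₀) ⟧
descent-step true  true  true  true  true  _ _ _ = refl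
descent-step true  true  true  true  false _ _ r = ⊥-elim (r tt tt)
descent-step true  true  true  false true  _ _ _ = refl
descent-step true  true  true  false false _ _ _ = refl
descent-step true  true  false true  d₁    _ _ _ = refl
descent-step true  true  false false d₁    _ _ _ = refl
descent-step true  false b₂    d₀    d₁    _ _ _ = refl
descent-step false true  b₂    true  d₁    p _ _ = ⊥-elim (p tt)
descent-step false true  true  false true  _ _ _ = refl
descent-step false true  true  false false _ _ _ = refl
descent-step false true  false false d₁    _ _ _ = refl
descent-step false false b₂    d₀    d₁    _ _ _ = refl

-- Modelled on a = leftWord Γ, b = rightWord Γ and d = diagAt Γ for an antichain Γ
-- of positive roots of type A_{m+1}.
record Compatible (m : ℕ) (a b d : ℕ → Bool) : Set where
  field
    left-start  : a 0 ≡ true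
    right-end   : b (suc m) ≡ true
    diag⇒left   : ∀ k → k < suc m → T (d k) → T (a (suc k))
    diag⇒right  : ∀ k → k < suc m → T (d k) → T (b k)
    left-step   : ∀ k → k < m → T (d (suc k)) → T (a (suc k)) → T (d k)
    right-step  : ∀ k → k < m → T (d k) → T (b (suc k)) → T (d (suc k))
    left-last   : T (a (suc m)) → T (d m)
    right-first : T (b 0) → T (d 0)

module _ {m a b d} (compatible : Compatible m a b d) where
  open Compatible compatible

  ascents-shift : ∀ {a′} → a′ 0 ≡ true → (∀ k → k < suc m → a′ (suc k) ≡ a k ∧ not (d k)) →
    ascents (suc m) a + ⟦ d 0 ⟧ ≡ ascents (suc m) a′ + ⟦ d m ⟧
  ascents-shift {a′} a′-start a′-shift =
    trans (telescope (suc m) _ _ h step) (cong (_+_ (ascents (suc m) a′)) h-last)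
    where
    h : ℕ → ℕ
    h zero = ⟦ d 0 ⟧
    h (suc k) = ⟦ a (suc k) ∧ (not (a k) ∨ d k) ⟧
    h-last : h (suc m) ≡ ⟦ d m ⟧
    h-last = ⟦∧∨⟧-equivalent (not (a m)) left-last (diag⇒left m ≤-refl)
    step : ∀ k → k < suc m →
      ⟦ a (suc k) ∧ not (a k) ⟧ + h k ≡ ⟦ a′ (suc k) ∧ not (a′ k) ⟧ + h (suc k)
    step zero _ rewrite left-start | a′-start | ∧-zeroʳ (a 1) | ∧-zeroʳ (a′ 1) =
      sym (⟦∧⟧-implied (diag⇒left 0 (s≤s z≤n)))
    step (suc j) 1+j<1+m rewrite a′-shift (suc j) 1+j<1+m | a′-shift j (m<n⇒m<1+n (s≤s⁻¹ 1+j<1+m)) =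
      ascent-step (a j) (a (suc j)) (a (suc (suc j))) (d j) (d (suc j))
        (diag⇒left j (<-trans (n<1+n j) 1+j<1+m)) (diag⇒left (suc j) 1+j<1+m)
        (left-step j (s≤s⁻¹ 1+j<1+m))

  descents-shift : ∀ {b′} → b′ (suc m) ≡ true →
    (∀ k → k < suc m → b′ k ≡ b (suc k) ∧ not (d k)) →
    descents (suc m) b + ⟦ d m ⟧ ≡ descents (suc m) b′ + ⟦ d 0 ⟧
  descents-shift {b′} b′-end b′-shift = begin
    descents (suc m) b + ⟦ d m ⟧   ≡⟨ cong (λ u → ∑< m s + u + ⟦ d m ⟧) (last-vanishes b right-end) ⟩
    ∑< m s + 0 + ⟦ d m ⟧          ≡⟨ cong (_+ ⟦ d m ⟧) (+-identityʳ (∑< m s)) ⟩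
    ∑< m s + ⟦ d m ⟧              ≡⟨ cong (_+_ (∑< m s)) (sym g-last) ⟩
    ∑< m s + g m                  ≡⟨ sym (telescope m t s g step) ⟩
    ∑< m t + g 0                  ≡⟨ cong (_+_ (∑< m t)) g-first ⟩
    ∑< m t + ⟦ d 0 ⟧              ≡⟨ cong (_+ ⟦ d 0 ⟧) (sym (+-identityʳ (∑< m t))) ⟩
    ∑< m t + 0 + ⟦ d 0 ⟧          ≡⟨ cong (λ u → ∑< m t + u + ⟦ d 0 ⟧) (sym (last-vanishes b′ b′-end)) ⟩
    descents (suc m) b′ + ⟦ d 0 ⟧ ∎
    where
    open ≡-Reasoning
    s t : ℕ → ℕ
    s k = ⟦ b k ∧ not (b (suc k)) ⟧
    t k = ⟦ b′ k ∧ not (b′ (suc k)) ⟧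
    last-vanishes : (w : ℕ → Bool) → w (suc m) ≡ true → ⟦ w m ∧ not (w (suc m)) ⟧ ≡ 0
    last-vanishes w w-end rewrite w-end = cong ⟦_⟧ (∧-zeroʳ (w m))
    g : ℕ → ℕ
    g k = ⟦ b k ∧ (not (b (suc k)) ∨ d k) ⟧
    g-first : g 0 ≡ ⟦ d 0 ⟧
    g-first = ⟦∧∨⟧-equivalent (not (b 1)) right-first (diag⇒right 0 (s≤s z≤n))
    g-last : g m ≡ ⟦ d m ⟧
    g-last rewrite right-end = ⟦∧⟧-implied (diag⇒right m ≤-refl)
    step : ∀ k → k < m → t k + g k ≡ s k + g (suc k)
    step k k<m rewrite b′-shift k (m<n⇒m<1+n k<m) | b′-shift (suc k) (s≤s k<m) =
      sym (descent-step (b k) (b (suc k)) (b (suc (suc k))) (d k) (d (suc k))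
        (diag⇒right k (m<n⇒m<1+n k<m)) (diag⇒right (suc k) (s≤s k<m)) (right-step k k<m))

  ascents+descents-shift : ∀ {a′ b′} →
    a′ 0 ≡ true → (∀ k → k < suc m → a′ (suc k) ≡ a k ∧ not (d k)) →
    b′ (suc m) ≡ true → (∀ k → k < suc m → b′ k ≡ b (suc k) ∧ not (d k)) →
    ascents (suc m) a + descents (suc m) b ≡ ascents (suc m) a′ + descents (suc m) b′
  ascents+descents-shift {a′} {b′} a′-start a′-shift b′-end b′-shift = +-cancelʳ-≡ _ _ _ (begin
    A + D + (⟦ d 0 ⟧ + ⟦ d m ⟧)     ≡⟨ interchange A D ⟦ d 0 ⟧ ⟦ d m ⟧ ⟩
    (A + ⟦ d 0 ⟧) + (D + ⟦ d m ⟧)   ≡⟨ cong₂ _+_ (ascents-shift {a′} a′-start a′-shift)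
                                                 (descents-shift {b′} b′-end b′-shift) ⟩
    (A′ + ⟦ d m ⟧) + (D′ + ⟦ d 0 ⟧) ≡⟨ interchange A′ ⟦ d m ⟧ D′ ⟦ d 0 ⟧ ⟩
    A′ + D′ + (⟦ d m ⟧ + ⟦ d 0 ⟧)   ≡⟨ cong (_+_ (A′ + D′)) (+-comm ⟦ d m ⟧ ⟦ d 0 ⟧) ⟩
    A′ + D′ + (⟦ d 0 ⟧ + ⟦ d m ⟧)   ∎)
    where
    open ≡-Reasoning
    A D A′ D′ : ℕ
    A = ascents (suc m) a
    D = descents (suc m) b
    A′ = ascents (suc m) a′
    D′ = descents (suc m) b′

module _ {n : ℕ} (Γ : Subset n) where

  startsAt endsAt : ℕ → Bool
  startsAt k = any (λ g → Γ g ∧ (lo g ≡ᵇ k)) (roots n)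
  endsAt k = any (λ g → Γ g ∧ (hi g ≡ᵇ k)) (roots n)

  private
    any-Γ⇔ : ∀ {p : Pair n → Bool} {P : Pair n → Set} → (∀ {g} → T (p g) ⇔ P g) →
      T (any (λ g → Γ g ∧ p g) (roots n)) ⇔ (∃[ g ] (g ∈ₛ Γ × P g))
    any-Γ⇔ p⇔P = mk⇔
      (λ h → let (g , g∈ , q) = to (any⇔ _ (roots n)) h
                 (Γg , pg) = T∧⁻ q
             in g , (g∈ , Γg) , to p⇔P pg)
      (λ (g , (g∈ , Γg) , Pg) → from (any⇔ _ (roots n)) (g , g∈ , T∧⁺ Γg (from p⇔P Pg)))

  startsAt⇔ : ∀ {k} → T (startsAt k) ⇔ (∃[ g ] (g ∈ₛ Γ × lo g ≡ k))
  startsAt⇔ = any-Γ⇔ ≡ᵇ⇔≡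

  endsAt⇔ : ∀ {k} → T (endsAt k) ⇔ (∃[ g ] (g ∈ₛ Γ × hi g ≡ k))
  endsAt⇔ = any-Γ⇔ ≡ᵇ⇔≡

  within? : ∀ c d → Dec (Within Γ c d)
  within? c d = Dec.map (mk⇔ reshape (λ (g , (g∈ , Γg) , c≤ , ≤d) → lose g∈ (Γg , c≤ , ≤d)))
    (Any.any? (λ g → T? (Γ g) ×-dec (c ≤? lo g) ×-dec (hi g ≤? d)) (roots n))
    where
    reshape : Any (λ g → T (Γ g) × c ≤ lo g × hi g ≤ d) (roots n) → Within Γ c d
    reshape h = let (g , g∈ , Γg , c≤ , ≤d) = find h in g , (g∈ , Γg) , c≤ , ≤d

  diagAt : ℕ → Bool
  diagAt k = ⌊ within? k k ⌋

  diagAt⇔ : ∀ {k} → T (diagAt k) ⇔ (∃[ g ] (g ∈ₛ Γ × lo g ≡ k × hi g ≡ k))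
  diagAt⇔ {k} = mk⇔
    (λ h → let (g , g∈ , k≤lo , hi≤k) = toWitness {a? = within? k k} h in
           g , g∈ , ≤-antisym (≤-trans (lo≤hi (proj₁ g∈)) hi≤k) k≤lo ,
                    ≤-antisym hi≤k (≤-trans k≤lo (lo≤hi (proj₁ g∈))))
    (λ (g , g∈ , lo≡ , hi≡) → fromWitness (g , g∈ , ≤-reflexive (sym lo≡) , ≤-reflexive hi≡))

  leftWord : ℕ → Bool
  leftWord zero = true
  leftWord (suc k) = startsAt k

  rightWord : ℕ → Bool
  rightWord k = (k ≡ᵇ n) ∨ endsAt k

  endsAt⇒rightWord : ∀ {k} → T (endsAt k) → T (rightWord k)
  endsAt⇒rightWord {k} = from (T-∨ {k ≡ᵇ n}) ∘ inj₂

  rightWord-end : rightWord n ≡ true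
  rightWord-end = cong (_∨ endsAt n) (≡ᵇ-refl n)

  rightWord-inside : ∀ {k} → k < n → rightWord k ≡ endsAt k
  rightWord-inside {k} k<n = cong (_∨ endsAt k) (<⇒≡ᵇ≡false k<n)

module _ {n : ℕ} where

  LeftCover RightCover : Pair n → Pair n → Set
  LeftCover γ x = suc (lo x) ≡ lo γ × hi x ≡ hi γ
  RightCover γ x = lo x ≡ lo γ × hi x ≡ suc (hi γ)

  module _ {γ x : Pair n} where

    leftCover-⊒ : LeftCover γ x → γ ⊑ x
    leftCover-⊒ (l , h) = subst (lo x ≤_) l (n≤1+n (lo x)) , ≤-reflexive (sym h)

    rightCover-⊒ : RightCover γ x → γ ⊑ x
    rightCover-⊒ (l , h) = ≤-reflexive l , subst (hi γ ≤_) (sym h) (n≤1+n (hi γ))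

    leftCover-≢ : LeftCover γ x → x ≢ γ
    leftCover-≢ (l , _) refl = 1+n≢n l

    rightCover-≢ : RightCover γ x → x ≢ γ
    rightCover-≢ (_ , h) refl = 1+n≢n (sym h)

    between-leftCover : ∀ {y} → LeftCover γ x → γ ⊑ y → y ⊑ x → y ≡ γ ⊎ y ≡ x
    between-leftCover {y} (l , h) (lo-y≤ , hi-γ≤) (lo-x≤ , hi-y≤) = case lo y ≟ lo x of λ
      { (yes e) → inj₂ (≡-byCoords e (trans hi-y≡hi-γ (sym h)))
      ; (no e)  → inj₁ (≡-byCoords (≤-antisym lo-y≤ (subst (_≤ lo y) l (≤∧≢⇒< lo-x≤ (e ∘ sym)))) hi-y≡hi-γ)
      }
      where
      hi-y≡hi-γ : hi y ≡ hi γ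
      hi-y≡hi-γ = ≤-antisym (≤-trans hi-y≤ (≤-reflexive h)) hi-γ≤

    between-rightCover : ∀ {y} → RightCover γ x → γ ⊑ y → y ⊑ x → y ≡ γ ⊎ y ≡ x
    between-rightCover {y} (l , h) (lo-y≤ , hi-γ≤) (lo-x≤ , hi-y≤) = case hi y ≟ hi x of λ
      { (yes e) → inj₂ (≡-byCoords (trans lo-y≡lo-γ (sym l)) e)
      ; (no e)  → inj₁ (≡-byCoords lo-y≡lo-γ (≤-antisym (s≤s⁻¹ (subst (suc (hi y) ≤_) h (≤∧≢⇒< hi-y≤ e))) hi-γ≤))
      }
      where
      lo-y≡lo-γ : lo y ≡ lo γ
      lo-y≡lo-γ = ≤-antisym lo-y≤ (subst (_≤ lo y) l lo-x≤)

module _ {n : ℕ} {Γ : Subset n} (ac : Antichain Γ) where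

  same-start : ∀ {x y} → x ∈ₛ Γ → y ∈ₛ Γ → lo x ≡ lo y → x ≡ y
  same-start {x} {y} x∈ y∈ e with ≤-total (hi x) (hi y)
  ... | inj₁ p = ac x∈ y∈ (≤-reflexive (sym e) , p)
  ... | inj₂ p = sym (ac y∈ x∈ (≤-reflexive e , p))

  same-end : ∀ {x y} → x ∈ₛ Γ → y ∈ₛ Γ → hi x ≡ hi y → x ≡ y
  same-end {x} {y} x∈ y∈ e with ≤-total (lo x) (lo y)
  ... | inj₁ p = sym (ac y∈ x∈ (p , ≤-reflexive (sym e)))
  ... | inj₂ p = ac x∈ y∈ (p , ≤-reflexive e)

  private
    count-by : (c : Pair n → ℕ) → (∀ {x y} → x ∈ₛ Γ → y ∈ₛ Γ → c x ≡ c y → x ≡ y) →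
      ∀ k → ∑[ x ∈ roots n ] ⟦ Γ x ∧ (c x ≡ᵇ k) ⟧ ≡ ⟦ any (λ x → Γ x ∧ (c x ≡ᵇ k)) (roots n) ⟧
    count-by c injective k = count-atMostOne _ roots-unique λ x∈ y∈ px py →
      let (Γx , cx≡k) = T∧⁻ px
          (Γy , cy≡k) = T∧⁻ py
      in injective (x∈ , Γx) (y∈ , Γy) (trans (≡ᵇ⇒≡ _ k cx≡k) (sym (≡ᵇ⇒≡ _ k cy≡k)))

  count-starts : ∀ k → ∑[ x ∈ roots n ] ⟦ Γ x ∧ (lo x ≡ᵇ k) ⟧ ≡ ⟦ startsAt Γ k ⟧
  count-starts = count-by lo same-start

  count-ends : ∀ k → ∑[ x ∈ roots n ] ⟦ Γ x ∧ (hi x ≡ᵇ k) ⟧ ≡ ⟦ endsAt Γ k ⟧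
  count-ends = count-by hi same-end

  member-minimal : ∀ {x y} → x ∈ₛ Γ → Within Γ (lo y) (hi y) → y ⊑ x → y ≡ x
  member-minimal x∈ (g , g∈ , g⊑y) y⊑x with ac g∈ x∈ (⊑-trans g⊑y y⊑x)
  ... | refl = ⊑-antisym y⊑x g⊑y

  minOf-upper : ∀ {x} → Root x → minOf (upper Γ) x ≡ Γ x
  minOf-upper {x} x∈ = T-ext (forth ∘ to (minOf⇔ x∈)) (from (minOf⇔ x∈) ∘ back)
    where
    forth : IsMin (upper Γ) x → T (Γ x)
    forth ((_ , up) , minimal) with to (upper⇔ {Γ = Γ}) up
    ... | g , (g∈ , Γg) , g⊑x =
      subst (T ∘ Γ) (minimal (g∈ , from (upper⇔ {Γ = Γ}) (g , (g∈ , Γg) , ⊑-refl)) g⊑x) Γg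
    back : T (Γ x) → IsMin (upper Γ) x
    back Γx = (x∈ , from (upper⇔ {Γ = Γ}) (x , (x∈ , Γx) , ⊑-refl)) ,
              λ (_ , up) → member-minimal (x∈ , Γx) (to (upper⇔ {Γ = Γ}) up)

-- The minimal elements of 𝓘(Γ) ∖ {γ}

module Removal {n : ℕ} {Γ : Subset n} (ac : Antichain Γ) {γ : Pair n} (γ∈Γ : γ ∈ₛ Γ) where

  S : Subset n
  S = remove (upper Γ) γ

  S⇔ : ∀ {y} → T (S y) ⇔ (Within Γ (lo y) (hi y) × y ≢ γ)
  S⇔ = mk⇔
    (λ h → let (up , y≠γ) = T∧⁻ h in to upper⇔ up , T-not⁻ y≠γ ∘ from ==⇔≡)
    (λ (w , y≢γ) → T∧⁺ (from upper⇔ w) (T-not⁺ (y≢γ ∘ to ==⇔≡)))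

  Kept NewLeft NewRight : Pair n → Set
  Kept x = x ∈ₛ Γ × x ≢ γ
  NewLeft x = LeftCover γ x × ¬ T (leftWord Γ (lo γ))
  NewRight x = RightCover γ x × ¬ T (rightWord Γ (suc (hi γ)))

  no-start : ∀ {k} → suc k ≡ lo γ → ¬ T (leftWord Γ (lo γ)) → ∀ {g} → g ∈ₛ Γ → lo g ≢ k
  no-start e ¬left g∈ lo-g≡k = ¬left (subst (T ∘ leftWord Γ) e
    (from (startsAt⇔ Γ) (_ , g∈ , lo-g≡k)))

  no-end : ¬ T (rightWord Γ (suc (hi γ))) → ∀ {g} → g ∈ₛ Γ → hi g ≢ suc (hi γ)
  no-end ¬right g∈ hi-g≡ = ¬right (endsAt⇒rightWord Γ (from (endsAt⇔ Γ) (_ , g∈ , hi-g≡)))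

  kept-minimal : ∀ {x} → Kept x → IsMin S x
  kept-minimal {x} ((x∈ , Γx) , x≢γ) =
    (x∈ , from S⇔ ((x , (x∈ , Γx) , ⊑-refl) , x≢γ)) ,
    λ (_ , Sy) → member-minimal ac (x∈ , Γx) (proj₁ (to S⇔ Sy))

  -- Below a new minimal element x the only element of Γ is γ, so anything of
  -- 𝓘(Γ) below x lies between γ and its cover x.
  newLeft-minimal : ∀ {x} → Root x → NewLeft x → IsMin S x
  newLeft-minimal {x} x∈ (cover , ¬left) =
    (x∈ , from S⇔ ((γ , γ∈Γ , leftCover-⊒ cover) , leftCover-≢ cover)) , minimal
    where
    minimal : ∀ {y} → y ∈ₛ S → y ⊑ x → y ≡ x
    minimal {y} (_ , Sy) y⊑x with to S⇔ Sy
    ... | (g , g∈ , g⊑y) , y≢γ with ⊑-trans g⊑y y⊑x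
    ...   | lo-x≤ , hi-g≤ with ac g∈ γ∈Γ
            (subst (_≤ lo g) (proj₁ cover) (≤∧≢⇒< lo-x≤ (no-start (proj₁ cover) ¬left g∈ ∘ sym)) ,
             ≤-trans hi-g≤ (≤-reflexive (proj₂ cover)))
    ...     | refl with between-leftCover cover g⊑y y⊑x
    ...       | inj₁ y≡γ = ⊥-elim (y≢γ y≡γ)
    ...       | inj₂ y≡x = y≡x

  newRight-minimal : ∀ {x} → Root x → NewRight x → IsMin S x
  newRight-minimal {x} x∈ (cover , ¬right) =
    (x∈ , from S⇔ ((γ , γ∈Γ , rightCover-⊒ cover) , rightCover-≢ cover)) , minimal
    where
    minimal : ∀ {y} → y ∈ₛ S → y ⊑ x → y ≡ x
    minimal {y} (_ , Sy) y⊑x with to S⇔ Sy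
    ... | (g , g∈ , g⊑y) , y≢γ with ⊑-trans g⊑y y⊑x
    ...   | lo-x≤ , hi-g≤ with ac g∈ γ∈Γ
            (subst (_≤ lo g) (proj₁ cover) lo-x≤ ,
             s≤s⁻¹ (subst (suc (hi g) ≤_) (proj₂ cover)
                     (≤∧≢⇒< hi-g≤ (no-end ¬right g∈ ∘ flip trans (proj₂ cover)))))
    ...     | refl with between-rightCover cover g⊑y y⊑x
    ...       | inj₁ y≡γ = ⊥-elim (y≢γ y≡γ)
    ...       | inj₂ y≡x = y≡x

  module _ {x : Pair n} (x-min : IsMin S x) (¬Γx : ¬ T (Γ x)) where

    private
      minimal : ∀ {y} → y ∈ₛ S → y ⊑ x → y ≡ x
      minimal = proj₂ x-min
      x≢γ : x ≢ γ
      x≢γ = proj₂ (to S⇔ (proj₂ (proj₁ x-min)))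

    only-γ-below : ∀ {g} → g ∈ₛ Γ → g ⊑ x → g ≡ γ
    only-γ-below {g} g∈ g⊑x with ≡-dec _≟F_ _≟F_ g γ
    ... | yes g≡γ = g≡γ
    ... | no g≢γ = ⊥-elim (¬Γx (subst (T ∘ Γ)
                     (minimal (proj₁ g∈ , from S⇔ ((g , g∈ , ⊑-refl) , g≢γ)) g⊑x) (proj₂ g∈)))

    γ⊑x : γ ⊑ x
    γ⊑x with to S⇔ (proj₂ (proj₁ x-min))
    ... | (g , g∈ , g⊑x) , _ = subst (_⊑ x) (only-γ-below g∈ g⊑x) g⊑x

    newLeft-case : lo x < lo γ → NewLeft x
    newLeft-case lo-x<lo-γ = subst (LeftCover γ) ℓ≡x ℓ-cover , ¬left
      where
      i : ℕ
      i = proj₁ (<-predecessor lo-x<lo-γ)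
      1+i≡lo-γ : suc i ≡ lo γ
      1+i≡lo-γ = proj₁ (proj₂ (<-predecessor lo-x<lo-γ))
      lo-x≤i : lo x ≤ i
      lo-x≤i = proj₂ (proj₂ (<-predecessor lo-x<lo-γ))
      L : ∃[ ℓ ] (Root ℓ × lo ℓ ≡ i × hi ℓ ≡ hi γ)
      L = rootAt (≤-trans (n≤1+n i) (subst (_≤ hi γ) (sym 1+i≡lo-γ) (lo≤hi (proj₁ γ∈Γ)))) (hi<n γ)
      ℓ : Pair n
      ℓ = proj₁ L
      ℓ-cover : LeftCover γ ℓ
      ℓ-cover = trans (cong suc (proj₁ (proj₂ (proj₂ L)))) 1+i≡lo-γ , proj₂ (proj₂ (proj₂ L))
      ℓ≡x : ℓ ≡ x
      ℓ≡x = minimal (proj₁ (proj₂ L) , from S⇔ ((γ , γ∈Γ , leftCover-⊒ ℓ-cover) , leftCover-≢ ℓ-cover))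
                    (subst (lo x ≤_) (sym (proj₁ (proj₂ (proj₂ L)))) lo-x≤i ,
                     subst (_≤ hi x) (sym (proj₂ ℓ-cover)) (proj₂ γ⊑x))
      is-γ : ∀ {g} → g ∈ₛ Γ → lo g ≡ i → g ≡ γ
      is-γ {g} g∈ lo-g≡i with hi g ≤? hi x
      ... | yes hi-g≤ = only-γ-below g∈ (subst (lo x ≤_) (sym lo-g≡i) lo-x≤i , hi-g≤)
      ... | no hi-g≰ = sym (ac γ∈Γ g∈ (subst (_≤ lo γ) (sym lo-g≡i) (subst (i ≤_) 1+i≡lo-γ (n≤1+n i)) ,
                                       ≤-trans (proj₂ γ⊑x) (<⇒≤ (≰⇒> hi-g≰))))
      ¬left : ¬ T (leftWord Γ (lo γ))
      ¬left h with to (startsAt⇔ Γ) (subst (T ∘ leftWord Γ) (sym 1+i≡lo-γ) h)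
      ... | g , g∈ , lo-g≡i = 1+n≢n (trans 1+i≡lo-γ (trans (cong lo (sym (is-γ g∈ lo-g≡i))) lo-g≡i))

    newRight-case : ¬ lo x < lo γ → NewRight x
    newRight-case lo-x≮lo-γ = subst (RightCover γ) r≡x r-cover , ¬right
      where
      lo-x≡lo-γ : lo x ≡ lo γ
      lo-x≡lo-γ = ≤-antisym (proj₁ γ⊑x) (≮⇒≥ lo-x≮lo-γ)
      hi-γ<hi-x : hi γ < hi x
      hi-γ<hi-x = ≤∧≢⇒< (proj₂ γ⊑x) λ e → x≢γ (≡-byCoords lo-x≡lo-γ (sym e))
      R : ∃[ r ] (Root r × lo r ≡ lo γ × hi r ≡ suc (hi γ))
      R = rootAt (≤-trans (lo≤hi (proj₁ γ∈Γ)) (n≤1+n (hi γ))) (≤-<-trans hi-γ<hi-x (hi<n x))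
      r : Pair n
      r = proj₁ R
      r-cover : RightCover γ r
      r-cover = proj₂ (proj₂ R)
      r≡x : r ≡ x
      r≡x = minimal (proj₁ (proj₂ R) , from S⇔ ((γ , γ∈Γ , rightCover-⊒ r-cover) , rightCover-≢ r-cover))
                    (≤-reflexive (trans lo-x≡lo-γ (sym (proj₁ r-cover))) ,
                     subst (_≤ hi x) (sym (proj₂ r-cover)) hi-γ<hi-x)
      is-γ : ∀ {g} → g ∈ₛ Γ → hi g ≡ suc (hi γ) → g ≡ γ
      is-γ {g} g∈ hi-g≡ with lo x ≤? lo g
      ... | yes lo-x≤ = only-γ-below g∈ (lo-x≤ , subst (_≤ hi x) (sym hi-g≡) hi-γ<hi-x)
      ... | no lo-x≰ = sym (ac γ∈Γ g∈ (subst (lo g ≤_) lo-x≡lo-γ (<⇒≤ (≰⇒> lo-x≰)) ,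
                                       subst (hi γ ≤_) (sym hi-g≡) (n≤1+n (hi γ))))
      ¬right : ¬ T (rightWord Γ (suc (hi γ)))
      ¬right h with to (endsAt⇔ Γ) (subst T (rightWord-inside Γ (≤-<-trans hi-γ<hi-x (hi<n x))) h)
      ... | g , g∈ , hi-g≡ = 1+n≢n (trans (sym hi-g≡) (cong hi (is-γ g∈ hi-g≡)))

  minimal-cases : ∀ {x} → IsMin S x → Kept x ⊎ NewLeft x ⊎ NewRight x
  minimal-cases {x} x-min@((x∈ , Sx) , _) with T? (Γ x)
  ... | yes Γx = inj₁ ((x∈ , Γx) , proj₂ (to S⇔ Sx))
  ... | no ¬Γx with lo x <? lo γ
  ...   | yes lo-x<lo-γ = inj₂ (inj₁ (newLeft-case x-min ¬Γx lo-x<lo-γ))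
  ...   | no lo-x≮lo-γ = inj₂ (inj₂ (newRight-case x-min ¬Γx lo-x≮lo-γ))

  kept newLeft newRight : Pair n → Bool
  kept x = Γ x ∧ not (x == γ)
  newLeft x = ((suc (lo x) ≡ᵇ lo γ) ∧ (hi x ≡ᵇ hi γ)) ∧ not (leftWord Γ (lo γ))
  newRight x = ((lo x ≡ᵇ lo γ) ∧ (hi x ≡ᵇ suc (hi γ))) ∧ not (rightWord Γ (suc (hi γ)))

  private
    coords⇔ : ∀ {a b c d w} → T (((a ≡ᵇ b) ∧ (c ≡ᵇ d)) ∧ not w) ⇔ ((a ≡ b × c ≡ d) × ¬ T w)
    coords⇔ = mk⇔
      (λ h → let (eqs , ¬w) = T∧⁻ h ; (e₁ , e₂) = T∧⁻ eqs in
             (≡ᵇ⇒≡ _ _ e₁ , ≡ᵇ⇒≡ _ _ e₂) , T-not⁻ ¬w)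
      (λ ((e₁ , e₂) , ¬w) → T∧⁺ (T∧⁺ (≡⇒≡ᵇ _ _ e₁) (≡⇒≡ᵇ _ _ e₂)) (T-not⁺ ¬w))

  newLeft⇔ : ∀ {x} → T (newLeft x) ⇔ NewLeft x
  newLeft⇔ {x} = coords⇔ {suc (lo x)} {lo γ} {hi x} {hi γ} {leftWord Γ (lo γ)}

  newRight⇔ : ∀ {x} → T (newRight x) ⇔ NewRight x
  newRight⇔ {x} = coords⇔ {lo x} {lo γ} {hi x} {suc (hi γ)} {rightWord Γ (suc (hi γ))}

  kept⇔ : ∀ {x} → Root x → T (kept x) ⇔ Kept x
  kept⇔ x∈ = mk⇔
    (λ h → let (Γx , x≠γ) = T∧⁻ h in (x∈ , Γx) , T-not⁻ x≠γ ∘ from ==⇔≡)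
    (λ ((_ , Γx) , x≢γ) → T∧⁺ Γx (T-not⁺ (x≢γ ∘ to ==⇔≡)))

  minOf-partition : ∀ {x} → Root x → ⟦ minOf S x ⟧ ≡ ⟦ kept x ⟧ + ⟦ newLeft x ⟧ + ⟦ newRight x ⟧
  minOf-partition {x} x∈ = ⟦⟧-partition (mk⇔ forth back)
    (λ k l → kept-newLeft (to (kept⇔ x∈) k) (to newLeft⇔ l))
    (λ k r → kept-newRight (to (kept⇔ x∈) k) (to newRight⇔ r))
    (λ l r → 1+n≢n (trans (proj₁ (proj₁ (to (newLeft⇔ {x}) l)))
                          (sym (proj₁ (proj₁ (to (newRight⇔ {x}) r))))))
    where
    kept-newLeft : Kept x → ¬ NewLeft x
    kept-newLeft (x∈Γ , x≢γ) (cover , _) = x≢γ (sym (ac γ∈Γ x∈Γ (leftCover-⊒ cover)))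
    kept-newRight : Kept x → ¬ NewRight x
    kept-newRight (x∈Γ , x≢γ) (cover , _) = x≢γ (sym (ac γ∈Γ x∈Γ (rightCover-⊒ cover)))
    forth : T (minOf S x) → T (kept x) ⊎ T (newLeft x) ⊎ T (newRight x)
    forth h with minimal-cases (to (minOf⇔ x∈) h)
    ... | inj₁ k = inj₁ (from (kept⇔ x∈) k)
    ... | inj₂ (inj₁ l) = inj₂ (inj₁ (from newLeft⇔ l))
    ... | inj₂ (inj₂ r) = inj₂ (inj₂ (from newRight⇔ r))
    back : T (kept x) ⊎ T (newLeft x) ⊎ T (newRight x) → T (minOf S x)
    back (inj₁ k) = from (minOf⇔ x∈) (kept-minimal (to (kept⇔ x∈) k))
    back (inj₂ (inj₁ l)) = from (minOf⇔ x∈) (newLeft-minimal x∈ (to newLeft⇔ l))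
    back (inj₂ (inj₂ r)) = from (minOf⇔ x∈) (newRight-minimal x∈ (to newRight⇔ r))

  count-kept : ∑[ x ∈ roots n ] ⟦ kept x ⟧ + 1 ≡ ∑[ x ∈ roots n ] ⟦ Γ x ⟧
  count-kept = begin
    ∑[ x ∈ roots n ] ⟦ kept x ⟧ + 1
      ≡⟨ cong (_+_ (∑[ x ∈ roots n ] ⟦ kept x ⟧))
              (sym (count-exactlyOne (_== γ) roots-unique (proj₁ γ∈Γ) (λ _ → ==⇔≡))) ⟩
    ∑[ x ∈ roots n ] ⟦ kept x ⟧ + ∑[ x ∈ roots n ] ⟦ x == γ ⟧
      ≡⟨ sym (∑-+ (roots n) _ _) ⟩
    ∑[ x ∈ roots n ] (⟦ kept x ⟧ + ⟦ x == γ ⟧)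
      ≡⟨ ∑-cong (roots n) (λ _ → sym (⟦⟧-split λ x≡γ →
           subst (T ∘ Γ) (sym (to ==⇔≡ x≡γ)) (proj₂ γ∈Γ))) ⟩
    ∑[ x ∈ roots n ] ⟦ Γ x ⟧ ∎
    where open ≡-Reasoning

  count-newLeft : ∑[ x ∈ roots n ] ⟦ newLeft x ⟧ ≡ ⟦ not (leftWord Γ (lo γ)) ⟧
  count-newLeft = trans (∑-cong (roots n) (λ {x} _ → ⟦∧⟧ _ (not (leftWord Γ (lo γ)))))
                 (trans (∑-*ʳ (roots n) _ _) (cover-count (lo γ) (lo≤hi (proj₁ γ∈Γ))))
    where
    cover-count : ∀ i → i ≤ hi γ →
      (∑[ x ∈ roots n ] ⟦ (suc (lo x) ≡ᵇ i) ∧ (hi x ≡ᵇ hi γ) ⟧) * ⟦ not (leftWord Γ i) ⟧ ≡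
      ⟦ not (leftWord Γ i) ⟧
    cover-count zero _ = *-zeroʳ (∑[ x ∈ roots n ] ⟦ (suc (lo x) ≡ᵇ 0) ∧ (hi x ≡ᵇ hi γ) ⟧)
    cover-count (suc i) 1+i≤ = trans (cong (_* _) (count-at (<⇒≤ 1+i≤) (hi<n γ))) (*-identityˡ _)

  count-newRight : ∑[ x ∈ roots n ] ⟦ newRight x ⟧ ≡ ⟦ not (rightWord Γ (suc (hi γ))) ⟧
  count-newRight = trans (∑-cong (roots n) (λ {x} _ → ⟦∧⟧ _ (not (rightWord Γ (suc (hi γ))))))
                  (trans (∑-*ʳ (roots n) _ _)
                         (cover-count (suc (hi γ)) (≤-trans (lo≤hi (proj₁ γ∈Γ)) (n≤1+n _)) (hi<n γ)))
    where
    cover-count : ∀ j → lo γ ≤ j → j ≤ n →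
      (∑[ x ∈ roots n ] ⟦ (lo x ≡ᵇ lo γ) ∧ (hi x ≡ᵇ j) ⟧) * ⟦ not (rightWord Γ j) ⟧ ≡
      ⟦ not (rightWord Γ j) ⟧
    cover-count j lo-γ≤j j≤n with j <? n
    ... | yes j<n = trans (cong (_* _) (count-at lo-γ≤j j<n)) (*-identityˡ _)
    ... | no j≮n rewrite ≤-antisym j≤n (≮⇒≥ j≮n) | ≡ᵇ-refl n =
      *-zeroʳ (∑[ x ∈ roots n ] ⟦ (lo x ≡ᵇ lo γ) ∧ (hi x ≡ᵇ n) ⟧)

  card-minimal-removal : card (minOf S) + 1 ≡
    card (minOf (upper Γ)) + (⟦ not (leftWord Γ (lo γ)) ⟧ + ⟦ not (rightWord Γ (suc (hi γ))) ⟧)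
  card-minimal-removal = begin
    card (minOf S) + 1
      ≡⟨ cong (_+ 1) (trans (card≡∑ (minOf S)) (∑-cong (roots n) minOf-partition)) ⟩
    ∑[ x ∈ roots n ] (⟦ kept x ⟧ + ⟦ newLeft x ⟧ + ⟦ newRight x ⟧) + 1
      ≡⟨ cong (_+ 1) (trans (∑-+ (roots n) (λ x → ⟦ kept x ⟧ + ⟦ newLeft x ⟧) (λ x → ⟦ newRight x ⟧))
                            (cong (_+ ∑[ x ∈ roots n ] ⟦ newRight x ⟧) (∑-+ (roots n) _ _))) ⟩
    K + ∑[ x ∈ roots n ] ⟦ newLeft x ⟧ + ∑[ x ∈ roots n ] ⟦ newRight x ⟧ + 1
      ≡⟨ cong₂ (λ l r → K + l + r + 1) count-newLeft count-newRight ⟩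
    K + L + R + 1
      ≡⟨ rearrange K L R ⟩
    K + 1 + (L + R)
      ≡⟨ cong (_+ (L + R)) count-kept ⟩
    ∑[ x ∈ roots n ] ⟦ Γ x ⟧ + (L + R)
      ≡⟨ cong (_+ (L + R)) (sym (trans (card≡∑ (minOf (upper Γ)))
                                       (∑-cong (roots n) (cong ⟦_⟧ ∘ minOf-upper ac)))) ⟩
    card (minOf (upper Γ)) + (L + R) ∎
    where
    open ≡-Reasoning
    rearrange : ∀ k l r → k + l + r + 1 ≡ k + 1 + (l + r)
    rearrange = solve-∀
    K L R : ℕ
    K = ∑[ x ∈ roots n ] ⟦ kept x ⟧
    L = ⟦ not (leftWord Γ (lo γ)) ⟧
    R = ⟦ not (rightWord Γ (suc (hi γ))) ⟧

  rΓ-formula : rΓ Γ γ ≡ + (⟦ not (leftWord Γ (lo γ)) ⟧ + ⟦ not (rightWord Γ (suc (hi γ))) ⟧)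
  rΓ-formula = difference+1 {b = card (minOf (upper Γ))} card-minimal-removal
    where
    difference+1 : ∀ {a b v} → a + 1 ≡ b + v → (+ a ℤ.- + b) ℤ.+ + 1 ≡ + v
    difference+1 {a} {b} {v} e = begin
      (+ a ℤ.- + b) ℤ.+ + 1 ≡⟨ cong (ℤ._+ + 1) ([+m]-[+n]≡m⊖n a b) ⟩
      (a ⊖ b) ℤ.+ + 1       ≡⟨ distribˡ-⊖-+-pos 1 a b ⟩
      (a + 1) ⊖ b           ≡⟨ cong (_⊖ b) e ⟩
      (b + v) ⊖ b           ≡⟨ ⊖-≥ (m≤m+n b v) ⟩
      + (b + v ∸ b)         ≡⟨ cong +_ (m+n∸m≡n b v) ⟩
      + v                   ∎
      where open ≡-Reasoning

-- The OY-number as ascents and descents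

module _ {A : Set} where

  foldr-+-filter : ∀ xs (S : A → Bool) (f : A → ℤ) (g : A → ℕ) →
    (∀ {x} → x ∈ xs → T (S x) → f x ≡ + g x) →
    foldr ℤ._+_ (+ 0) (map f (filter (λ x → T? (S x)) xs)) ≡ + ∑[ x ∈ xs ] (⟦ S x ⟧ * g x)
  foldr-+-filter [] S f g _ = refl
  foldr-+-filter (x ∷ xs) S f g f≡g with S x in e
  ... | true  = trans (cong₂ ℤ._+_ (f≡g (here refl) (subst T (sym e) tt))
                                   (foldr-+-filter xs S f g (f≡g ∘ there)))
                      (sym (trans (cong (λ k → + (k + ∑[ y ∈ xs ] (⟦ S y ⟧ * g y))) (+-identityʳ (g x)))
                                  (pos-+ (g x) _)))
  ... | false = foldr-+-filter xs S f g (f≡g ∘ there)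

module _ {n : ℕ} {Γ : Subset n} (ac : Antichain Γ) where

  𝒴-formula : 𝒴 Γ ≡ + (ascents n (leftWord Γ) + descents n (rightWord Γ))
  𝒴-formula = begin
    𝒴 Γ
      ≡⟨ foldr-+-filter (roots n) Γ (rΓ Γ) (λ x → L (lo x) + R (suc (hi x)))
           (λ x∈ Γx → Removal.rΓ-formula ac (x∈ , Γx)) ⟩
    + ∑[ x ∈ roots n ] (⟦ Γ x ⟧ * (L (lo x) + R (suc (hi x))))
      ≡⟨ cong +_ (trans (∑-cong (roots n) (λ {x} _ → *-distribˡ-+ ⟦ Γ x ⟧ _ _)) (∑-+ (roots n) _ _)) ⟩
    + (∑[ x ∈ roots n ] (⟦ Γ x ⟧ * L (lo x)) + ∑[ x ∈ roots n ] (⟦ Γ x ⟧ * R (suc (hi x))))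
      ≡⟨ cong +_ (cong₂ _+_ starts ends) ⟩
    + (ascents n (leftWord Γ) + descents n (rightWord Γ)) ∎
    where
    open ≡-Reasoning
    L R : ℕ → ℕ
    L k = ⟦ not (leftWord Γ k) ⟧
    R k = ⟦ not (rightWord Γ k) ⟧
    starts : ∑[ x ∈ roots n ] (⟦ Γ x ⟧ * L (lo x)) ≡ ascents n (leftWord Γ)
    starts = trans (∑-fibres (roots n) Γ lo L (λ {x} _ → toℕ<n (proj₁ x)))
      (∑<-cong n λ k _ → trans (cong (_* L k) (count-starts ac k)) (sym (⟦∧⟧ (startsAt Γ k) _)))
    ends : ∑[ x ∈ roots n ] (⟦ Γ x ⟧ * R (suc (hi x))) ≡ descents n (rightWord Γ)
    ends = trans (∑-fibres (roots n) Γ hi (R ∘ suc) (λ {x} _ → hi<n x))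
      (∑<-cong n λ k k<n → trans (cong (_* R (suc k)) (trans (count-ends ac k)
                                                              (cong ⟦_⟧ (sym (rightWord-inside Γ k<n)))))
                                 (sym (⟦∧⟧ (rightWord Γ k) _)))

-- The reverse operator

crossing : ∀ {P : ℕ → Set} → Decidable P → ∀ {a b} → a ≤ b → P a → ¬ P b →
  ∃[ k ] (a ≤ k × k < b × P k × ¬ P (suc k))
crossing P? {b = zero} z≤n Pa ¬Pb = ⊥-elim (¬Pb Pa)
crossing P? {a} {suc b} a≤1+b Pa ¬P1+b with P? b
... | yes Pb = b , s≤s⁻¹ (≤∧≢⇒< a≤1+b λ { refl → ¬P1+b Pa }) , ≤-refl , Pb , ¬P1+b
... | no ¬Pb with crossing P? (s≤s⁻¹ (≤∧≢⇒< a≤1+b λ { refl → ¬P1+b Pa })) Pa ¬Pb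
...   | k , a≤k , k<b , Pk , ¬P1+k = k , a≤k , m<n⇒m<1+n k<b , Pk , ¬P1+k

module Reverse {n : ℕ} {Γ : Subset n} (ac : Antichain Γ) where

  private
    J : Subset n
    J = compl (upper Γ)

    J⇔ : ∀ {x} → T (J x) ⇔ (¬ Within Γ (lo x) (hi x))
    J⇔ = mk⇔ (λ h → T-not⁻ h ∘ from upper⇔) (λ h → T-not⁺ (h ∘ to upper⇔))

    reverse⇔ : ∀ {x} → Root x → T (𝔛 Γ x) ⇔ IsMax J x
    reverse⇔ = maxOf⇔ {S = J}

  reverse-outside : ∀ {x} → x ∈ₛ 𝔛 Γ → ¬ Within Γ (lo x) (hi x)
  reverse-outside (x∈ , 𝔛x) = to J⇔ (proj₂ (proj₁ (to (reverse⇔ x∈) 𝔛x)))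

  reverse-extend : ∀ {x y} → x ∈ₛ 𝔛 Γ → Root y → x ⊑ y → y ≢ x → Within Γ (lo y) (hi y)
  reverse-extend {y = y} (x∈ , 𝔛x) y∈ x⊑y y≢x with within? Γ (lo y) (hi y)
  ... | yes w = w
  ... | no ¬w = ⊥-elim (y≢x (proj₂ (to (reverse⇔ x∈) 𝔛x) (y∈ , from J⇔ ¬w) x⊑y))

  reverse-intro : ∀ {x} → Root x → ¬ Within Γ (lo x) (hi x) →
    (∀ {y} → x ⊑ y → lo y < lo x → Within Γ (lo y) (hi y)) →
    (∀ {y} → x ⊑ y → hi x < hi y → Within Γ (lo y) (hi y)) → x ∈ₛ 𝔛 Γ
  reverse-intro {x} x∈ ¬w-x left-grown right-grown =
    x∈ , from (reverse⇔ x∈) ((x∈ , from J⇔ ¬w-x) , maximal)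
    where
    maximal : ∀ {y} → y ∈ₛ J → x ⊑ y → y ≡ x
    maximal {y} (_ , Jy) x⊑y@(lo-y≤ , hi-x≤) = ≡-byCoords
      (≤-antisym lo-y≤ (≮⇒≥ λ lo-y< → to J⇔ Jy (left-grown x⊑y lo-y<)))
      (≤-antisym (≮⇒≥ λ hi-x< → to J⇔ Jy (right-grown x⊑y hi-x<)) hi-x≤)

  reverse-antichain : Antichain (𝔛 Γ)
  reverse-antichain (x∈ , 𝔛x) (y∈ , 𝔛y) x⊑y =
    sym (proj₂ (to (reverse⇔ x∈) 𝔛x) (proj₁ (to (reverse⇔ y∈) 𝔛y)) x⊑y)

  reverse-no-diag : ∀ {x k} → x ∈ₛ 𝔛 Γ → lo x ≤ k → k ≤ hi x → ¬ T (diagAt Γ k)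
  reverse-no-diag x∈𝔛 lo-x≤k k≤hi-x diag with toWitness diag
  ... | g , g∈ , k≤lo-g , hi-g≤k = reverse-outside x∈𝔛 (g , g∈ , ≤-trans lo-x≤k k≤lo-g , ≤-trans hi-g≤k k≤hi-x)

  reverse-left : ∀ {x} → x ∈ₛ 𝔛 Γ → T (leftWord Γ (lo x))
  reverse-left {x} x∈𝔛@(x∈ , _) = go (lo x) refl
    where
    go : ∀ c → lo x ≡ c → T (leftWord Γ c)
    go zero _ = tt
    go (suc c) lo-x≡ with rootAt (≤-trans (n≤1+n c) (subst (_≤ hi x) lo-x≡ (lo≤hi x∈))) (hi<n x)
    ... | y , y∈ , lo-y , hi-y with reverse-extend x∈𝔛 y∈
            (subst (_≤ lo x) (sym lo-y) (subst (c ≤_) (sym lo-x≡) (n≤1+n c)) , ≤-reflexive (sym hi-y))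
            (λ y≡x → 1+n≢n (trans (trans (sym lo-x≡) (cong lo (sym y≡x))) lo-y))
    ...   | g , g∈ , lo-y≤ , hi-g≤ with lo g ≟ c
    ...     | yes lo-g≡c = from (startsAt⇔ Γ) (g , g∈ , lo-g≡c)
    ...     | no lo-g≢c = ⊥-elim (reverse-outside x∈𝔛 (g , g∈ , subst (_≤ lo g) (sym lo-x≡)
                              (≤∧≢⇒< (subst (_≤ lo g) lo-y lo-y≤) (lo-g≢c ∘ sym)) , subst (hi g ≤_) hi-y hi-g≤))

  reverse-right : ∀ {x} → x ∈ₛ 𝔛 Γ → T (rightWord Γ (suc (hi x)))
  reverse-right {x} x∈𝔛@(x∈ , _) with suc (hi x) <? n
  ... | no ¬1+hi-x<n = from T-∨ (inj₁ (≡⇒≡ᵇ _ _ (≤-antisym (hi<n x) (≮⇒≥ ¬1+hi-x<n))))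
  ... | yes 1+hi-x<n with rootAt (≤-trans (lo≤hi x∈) (n≤1+n (hi x))) 1+hi-x<n
  ...   | y , y∈ , lo-y , hi-y with reverse-extend x∈𝔛 y∈
            (≤-reflexive lo-y , subst (hi x ≤_) (sym hi-y) (n≤1+n (hi x)))
            (λ y≡x → 1+n≢n (trans (sym hi-y) (cong hi y≡x)))
  ...     | g , g∈ , lo-y≤ , hi-g≤ with hi g ≟ suc (hi x)
  ...       | yes hi-g≡ = endsAt⇒rightWord Γ (from (endsAt⇔ Γ) (g , g∈ , hi-g≡))
  ...       | no hi-g≢ = ⊥-elim (reverse-outside x∈𝔛 (g , g∈ , subst (_≤ lo g) lo-y lo-y≤ ,
                            s≤s⁻¹ (≤∧≢⇒< (subst (hi g ≤_) hi-y hi-g≤) hi-g≢)))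

  rightmost-outside : ∀ {c} → c < n → ¬ Within Γ c c →
    ∃[ d ] (c ≤ d × d < n × ¬ Within Γ c d × (suc d < n → Within Γ c (suc d)))
  rightmost-outside {c} c<n ¬w-cc
    with crossing (λ d → d <? n ×-dec ¬? (within? Γ c d)) (<⇒≤ c<n) (c<n , ¬w-cc) (<-irrefl refl ∘ proj₁)
  ... | d , c≤d , _ , (d<n , ¬w) , ¬next =
    d , c≤d , d<n , ¬w ,
    λ 1+d<n → Dec.decidable-stable (within? Γ c (suc d)) (λ ¬w′ → ¬next (1+d<n , ¬w′))

  leftmost-outside : ∀ {d} → ¬ Within Γ d d →
    ∃[ c ] (c ≤ d × ¬ Within Γ c d × (∀ {c′} → suc c′ ≡ c → Within Γ c′ d))
  leftmost-outside {d} ¬w-dd with within? Γ 0 d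
  ... | no ¬w = 0 , z≤n , ¬w , λ ()
  ... | yes w with crossing (λ k → within? Γ k d) z≤n w ¬w-dd
  ...   | k , _ , k<d , w-k , ¬w-1+k = suc k , k<d , ¬w-1+k , λ { refl → w-k }

  reverse-start : ∀ {c} → c < n → T (leftWord Γ c) → ¬ T (diagAt Γ c) → ∃[ x ] (x ∈ₛ 𝔛 Γ × lo x ≡ c)
  reverse-start {c} c<n left ¬diag with rightmost-outside c<n (¬diag ∘ fromWitness)
  ... | d , c≤d , d<n , ¬w , beyond with rootAt c≤d d<n
  ...   | x , x∈ , lo-x , hi-x =
    x , reverse-intro x∈ (subst₂ (λ a b → ¬ Within Γ a b) (sym lo-x) (sym hi-x) ¬w)
                         left-grown right-grown , lo-x
    where
    right-grown : ∀ {y} → x ⊑ y → hi x < hi y → Within Γ (lo y) (hi y)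
    right-grown {y} (lo-y≤ , _) hi-x< with beyond (≤-<-trans (subst (_< hi y) hi-x hi-x<) (hi<n y))
    ... | g , g∈ , c≤ , hi-g≤ = g , g∈ , ≤-trans (subst (lo y ≤_) lo-x lo-y≤) c≤ ,
                                ≤-trans hi-g≤ (subst (_< hi y) hi-x hi-x<)
    left-grown : ∀ {y} → x ⊑ y → lo y < lo x → Within Γ (lo y) (hi y)
    left-grown {y} (_ , hi-x≤) lo-y< with <-predecessor (subst (lo y <_) lo-x lo-y<)
    ... | c′ , refl , lo-y≤c′ with to (startsAt⇔ Γ) left
    ...   | g , g∈ , refl with hi g ≤? hi y
    ...     | yes hi-g≤ = g , g∈ , lo-y≤c′ , hi-g≤
    ...     | no hi-g≰ with subst (_< hi g) hi-x (≤-<-trans hi-x≤ (≰⇒> hi-g≰))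
    ...       | d<hi-g with beyond (≤-<-trans d<hi-g (hi<n g))
    ...         | h , h∈ , c≤ , hi-h≤ with ac h∈ g∈ (≤-trans (n≤1+n _) c≤ , ≤-trans hi-h≤ d<hi-g)
    ...           | refl = ⊥-elim (1+n≰n c≤)

  reverse-end : ∀ {d} → d < n → T (rightWord Γ (suc d)) → ¬ T (diagAt Γ d) → ∃[ x ] (x ∈ₛ 𝔛 Γ × hi x ≡ d)
  reverse-end {d} d<n right ¬diag with leftmost-outside (¬diag ∘ fromWitness)
  ... | c , c≤d , ¬w , before with rootAt c≤d d<n
  ...   | x , x∈ , lo-x , hi-x =
    x , reverse-intro x∈ (subst₂ (λ a b → ¬ Within Γ a b) (sym lo-x) (sym hi-x) ¬w)
                         left-grown right-grown , hi-x
    where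
    left-grown : ∀ {y} → x ⊑ y → lo y < lo x → Within Γ (lo y) (hi y)
    left-grown {y} (_ , hi-x≤) lo-y< with <-predecessor (subst (lo y <_) lo-x lo-y<)
    ... | c′ , c′+1≡c , lo-y≤c′ with before c′+1≡c
    ...   | h , h∈ , c′≤ , hi-h≤ = h , h∈ , ≤-trans lo-y≤c′ c′≤ , ≤-trans hi-h≤ (subst (_≤ hi y) hi-x hi-x≤)
    right-grown : ∀ {y} → x ⊑ y → hi x < hi y → Within Γ (lo y) (hi y)
    right-grown {y} (lo-y≤ , _) hi-x< with subst (_< hi y) hi-x hi-x<
    ... | d<hi-y with to (endsAt⇔ Γ) (subst T (rightWord-inside Γ (≤-<-trans d<hi-y (hi<n y))) right)
    ...   | g , g∈ , hi-g≡ with c ≤? lo g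
    ...     | yes c≤ = g , g∈ , ≤-trans (subst (lo y ≤_) lo-x lo-y≤) c≤ , subst (_≤ hi y) (sym hi-g≡) d<hi-y
    ...     | no c≰ with <-predecessor (≰⇒> c≰)
    ...       | c′ , c′+1≡c , lo-g≤c′ with before c′+1≡c
    ...         | h , h∈ , c′≤ , hi-h≤
                    with ac h∈ g∈ (≤-trans lo-g≤c′ c′≤ , ≤-trans hi-h≤ (subst (d ≤_) (sym hi-g≡) (n≤1+n d)))
    ...           | refl = ⊥-elim (1+n≰n (subst (_≤ d) hi-g≡ hi-h≤))

  startsAt-reverse : ∀ {c} → c < n → startsAt (𝔛 Γ) c ≡ leftWord Γ c ∧ not (diagAt Γ c)
  startsAt-reverse {c} c<n = T-ext
    (λ h → let (x , x∈𝔛 , lo-x≡c) = to (startsAt⇔ (𝔛 Γ)) h in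
           T∧⁺ (subst (T ∘ leftWord Γ) lo-x≡c (reverse-left x∈𝔛))
               (T-not⁺ (reverse-no-diag x∈𝔛 (≤-reflexive lo-x≡c)
                                            (subst (_≤ hi x) lo-x≡c (lo≤hi (proj₁ x∈𝔛))))))
    (λ h → let (left , ¬diag) = T∧⁻ h in
           from (startsAt⇔ (𝔛 Γ)) (reverse-start c<n left (T-not⁻ ¬diag)))

  endsAt-reverse : ∀ {d} → d < n → endsAt (𝔛 Γ) d ≡ rightWord Γ (suc d) ∧ not (diagAt Γ d)
  endsAt-reverse {d} d<n = T-ext
    (λ h → let (x , x∈𝔛 , hi-x≡d) = to (endsAt⇔ (𝔛 Γ)) h in
           T∧⁺ (subst (T ∘ rightWord Γ ∘ suc) hi-x≡d (reverse-right x∈𝔛))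
               (T-not⁺ (reverse-no-diag x∈𝔛 (subst (lo x ≤_) hi-x≡d (lo≤hi (proj₁ x∈𝔛)))
                                            (≤-reflexive (sym hi-x≡d)))))
    (λ h → let (right , ¬diag) = T∧⁻ h in
           from (endsAt⇔ (𝔛 Γ)) (reverse-end d<n right (T-not⁻ ¬diag)))

module _ {m : ℕ} {Γ : Subset (suc m)} where

  startsAt-last : T (startsAt Γ m) → T (diagAt Γ m)
  startsAt-last s with to (startsAt⇔ Γ) s
  ... | h , h∈ , lo-h = from (diagAt⇔ Γ)
    (h , h∈ , lo-h , ≤-antisym (s≤s⁻¹ (hi<n h)) (subst (_≤ hi h) lo-h (lo≤hi (proj₁ h∈))))

  rightWord-first : T (rightWord Γ 0) → T (diagAt Γ 0)
  rightWord-first r with to (endsAt⇔ Γ) r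
  ... | h , h∈ , hi-h = from (diagAt⇔ Γ)
    (h , h∈ , ≤-antisym (subst (lo h ≤_) hi-h (lo≤hi (proj₁ h∈))) z≤n , hi-h)

  module _ (ac : Antichain Γ) where

    diag-left-step : ∀ k → T (diagAt Γ (suc k)) → T (startsAt Γ k) → T (diagAt Γ k)
    diag-left-step k d s with to (diagAt⇔ Γ) d | to (startsAt⇔ Γ) s
    ... | g , g∈ , lo-g , hi-g | h , h∈ , lo-h with hi h ≤? k
    ...   | yes hi-h≤ = from (diagAt⇔ Γ)
                          (h , h∈ , lo-h , ≤-antisym hi-h≤ (subst (_≤ hi h) lo-h (lo≤hi (proj₁ h∈))))
    ...   | no hi-h≰ = ⊥-elim (1+n≢n (trans (sym lo-g) (trans (cong lo (ac g∈ h∈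
                          (subst (lo h ≤_) (sym lo-g) (subst (_≤ suc k) (sym lo-h) (n≤1+n k)) ,
                           subst (_≤ hi h) (sym hi-g) (≰⇒> hi-h≰)))) lo-h)))

    diag-right-step : ∀ k → k < m → T (diagAt Γ k) → T (rightWord Γ (suc k)) → T (diagAt Γ (suc k))
    diag-right-step k k<m d r
      with to (diagAt⇔ Γ) d | to (endsAt⇔ Γ) (subst T (rightWord-inside Γ (s≤s k<m)) r)
    ... | g , g∈ , lo-g , hi-g | h , h∈ , hi-h with suc k ≤? lo h
    ...   | yes ≤lo-h = from (diagAt⇔ Γ)
                          (h , h∈ , ≤-antisym (subst (lo h ≤_) hi-h (lo≤hi (proj₁ h∈))) ≤lo-h , hi-h)
    ...   | no ≰lo-h = ⊥-elim (1+n≢n (trans (sym hi-h) (trans (cong hi (sym (ac g∈ h∈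
                          (subst (lo h ≤_) (sym lo-g) (s≤s⁻¹ (≰⇒> ≰lo-h)) ,
                           subst (_≤ hi h) (sym hi-g) (subst (k ≤_) (sym hi-h) (n≤1+n k)))))) hi-g)))

    compatible : Compatible m (leftWord Γ) (rightWord Γ) (diagAt Γ)
    compatible = record
      { left-start  = refl
      ; right-end   = rightWord-end Γ
      ; diag⇒left   = λ _ _ d → let (g , g∈ , lo≡ , _) = to (diagAt⇔ Γ) d in
                                from (startsAt⇔ Γ) (g , g∈ , lo≡)
      ; diag⇒right  = λ _ _ d → let (g , g∈ , _ , hi≡) = to (diagAt⇔ Γ) d in
                                endsAt⇒rightWord Γ (from (endsAt⇔ Γ) (g , g∈ , hi≡))
      ; left-step   = λ k _ → diag-left-step k
      ; right-step  = diag-right-step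
      ; left-last   = startsAt-last
      ; right-first = rightWord-first
      }

mainTheorem2 : (n : ℕ) → n ≥ 1 → (Γ : Subset n) → IsAntichain Γ → 𝒴 Γ ≡ 𝒴 (𝔛 Γ)
mainTheorem2 (suc m) _ Γ isAntichain = begin
  𝒴 Γ                                                    ≡⟨ 𝒴-formula ac ⟩
  + (ascents n (leftWord Γ) + descents n (rightWord Γ))  ≡⟨ cong +_ words-invariant ⟩
  + (ascents n (leftWord Γ′) + descents n (rightWord Γ′)) ≡⟨ sym (𝒴-formula reverse-antichain) ⟩
  𝒴 Γ′                                                   ∎
  where
  open ≡-Reasoning
  n : ℕ
  n = suc m
  Γ′ : Subset n
  Γ′ = 𝔛 Γ
  ac : Antichain Γ
  ac = IsAntichain⇒Antichain Γ isAntichain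
  open Reverse ac
  words-invariant : ascents n (leftWord Γ) + descents n (rightWord Γ) ≡
                    ascents n (leftWord Γ′) + descents n (rightWord Γ′)
  words-invariant = ascents+descents-shift (compatible ac) {leftWord Γ′} {rightWord Γ′}
    refl (λ k → startsAt-reverse {k})
    (rightWord-end Γ′) (λ k k<n → trans (rightWord-inside Γ′ {k} k<n) (endsAt-reverse {k} k<n))
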